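{- For all basic types $t,s$ and all session types $T,S,T_1,T_2,T_3$, the following isomorphisms hold: (a1) $!t.!s.T\cong\ !s.!t.T$; (a2) $?t.?s.T\cong\ ?s.?t.T$; (a3) $!t.(T\oplus S)\cong\ !t.T\oplus\ !t.S$; (a4) $?t.(T+S)\cong\ ?t.T+\ ?t.S$; (a5) $!\mathsf{unit}.T\cong T$; (a6) $?\mathsf{unit}.T\cong T$; (a7) $!\mathsf{bool}.T\cong T\oplus T$; (a8) $?\mathsf{bool}.T\cong T+T$; (a9) $T\oplus S\cong S\oplus T$; (a10) $T+S\cong S+T$; (a11) $(T_1\oplus T_2)\oplus T_3\cong T_1\oplus(T_2\oplus T_3)$; (a12) $(T_1+T_2)+T_3\cong T_1+(T_2+T_3)$.
   Context: Channels: $\mathsf{c}\in\{\mathtt{l},\mathtt{r}\}$, with $\bar{\mathtt{l}}=\mathtt{r}$, $\bar{\mathtt{r}}=\mathtt{l}$; selectors $\ell\in\{\mathsf{inl},\mathsf{inr}\}$. Basic types include $\mathsf{unit}$ (value $()$), $\mathsf{bool}$ ($\mathsf{true},\mathsf{false}$), $\mathsf{int}$ (integers); $v\in t$ means basic value $v$ has basic type $t$. Expressions $e$: variables, basic values, $e_1=e_2$; deterministic evaluation $e\Downarrow v$. Processes: $P ::= \mathbf{0} \mid \mathsf{c}?(x:t).P \mid \mathsf{c}!e.P \mid \mathsf{c}\triangleleft\ell.P \mid \mathsf{c}\triangleright\{P,Q\} \mid \mathsf{if}\ e\ \mathsf{then}\ P\ \mathsf{else}\ Q \mid P\bowtie Q$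 (branching has $\mathsf{inl}$-branch $P$ and $\mathsf{inr}$-branch $Q$; in $P\bowtie Q$ the channel $\mathtt{r}$ of $P$ is connected to channel $\mathtt{l}$ of $Q$). Structural congruence $\equiv$: least congruence with $\mathbf{0}\bowtie\mathbf{0}\equiv\mathbf{0}$ and associativity of $\bowtie$. Reduction contexts $\mathcal{C}::=[\,]\mid\mathcal{C}\bowtie P\mid P\bowtie\mathcal{C}$. Reduction $\longrightarrow$: least relation with $\mathtt{r}!e.P\bowtie\mathtt{l}?(x:t).Q\longrightarrow P\bowtie Q\{v/x\}$ and $\mathtt{r}?(x:t).P\bowtie\mathtt{l}!e.Q\longrightarrow P\{v/x\}\bowtie Q$ (when $e\Downarrow v$, $v\in t$); $\mathtt{r}\triangleleft\ell.P\bowtie\mathtt{l}\triangleright\{Q_{\mathsf{inl}},Q_{\mathsf{inr}}\}\longrightarrow P\bowtie Q_\ell$; $\mathtt{r}\triangleright\{P_{\mathsf{inl}},P_{\mathsf{inr}}\}\bowtie\mathtt{l}\triangleleft\ell.Q\longrightarrow P_\ell\bowtie Q$; $\mathsf{if}\ e\ \mathsf{then}\ P_{\mathsf{true}}\ \mathsf{else}\ P_{\mathsf{false}}\longrightarrow P_v$ (when $e\Downarrow v\in\mathsf{bool}$); closed under reduction contexts and under $\equiv$. A process $P$ is correct if $P\longrightarrow^*Q\not\longrightarrow$ implies $Q\equiv\mathbf{0}$. Equivalence: $P\approx Q$ iff for every reduction context $\mathcal{C}$, $\mathcal{C}[P]$ is correct iff $\mathcal{C}[Q]$ is correct. Session types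 $T::=\mathtt{end}\mid ?t.T\mid !t.T\mid T+S\mid T\oplus S$ (input, output, branching, selection); the dual $\overline{T}$ swaps $?$ with $!$ and $+$ with $\oplus$. Typing judgment $\Gamma\vdash P\triangleright\mathsf{c}:T,\bar{\mathsf{c}}:S$ ($\Gamma$ maps variables to basic types), rules: $\Gamma,x:t\vdash x:t$; $\Gamma\vdash v:t$ if $v\in t$; $\Gamma\vdash e_1=e_2:\mathsf{bool}$ if both sides have a common type; input $\mathsf{c}?(x:t).P$ has $\mathsf{c}:?t.T,\bar{\mathsf c}:S$ if $P$ has $\mathsf{c}:T,\bar{\mathsf c}:S$ under $\Gamma,x:t$; output $\mathsf{c}!e.P$ has $\mathsf{c}:!t.T,\bar{\mathsf c}:S$ if $\Gamma\vdash e:t$ and $P$ has $\mathsf{c}:T,\bar{\mathsf c}:S$; $\mathsf{c}\triangleright\{P_1,P_2\}$ has $\mathsf{c}:T_1+T_2,\bar{\mathsf c}:S$ if each $P_i$ has $\mathsf{c}:T_i,\bar{\mathsf c}:S$; $\mathsf{c}\triangleleft\mathsf{inl}.P$ (resp. $\mathsf{inr}$) has $\mathsf{c}:T_1\oplus T_2,\bar{\mathsf c}:S$ if $P$ has $\mathsf{c}:T_1,\bar{\mathsf c}:S$ (resp. $T_2$); $\mathbf{0}$ has $\mathtt{l}:\mathtt{end},\mathtt{r}:\mathtt{end}$; $\mathsf{if}\ e\ \mathsf{then}\ P_1\ \mathsf{else}\ P_2$ has $\mathtt{l}:T,\mathtt{r}:S$ if $\Gamma\vdash e:\mathsf{bool}$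 and both $P_i$ have $\mathtt{l}:T,\mathtt{r}:S$; $P\bowtie Q$ has $\mathtt{l}:T,\mathtt{r}:S$ if $P$ has $\mathtt{l}:T,\mathtt{r}:T'$ and $Q$ has $\mathtt{l}:\overline{T'},\mathtt{r}:S$. Identity processes: $\mathrm{id}_{\mathtt{end}}=\mathbf{0}$; $\mathrm{id}_{!t.T}=\mathtt{l}?(x:t).\mathtt{r}!x.\mathrm{id}_T$; $\mathrm{id}_{?t.T}=\mathtt{r}?(x:t).\mathtt{l}!x.\mathrm{id}_T$; $\mathrm{id}_{T\oplus S}=\mathtt{l}\triangleright\{\mathtt{r}\triangleleft\mathsf{inl}.\mathrm{id}_T,\ \mathtt{r}\triangleleft\mathsf{inr}.\mathrm{id}_S\}$; $\mathrm{id}_{T+S}=\mathtt{r}\triangleright\{\mathtt{l}\triangleleft\mathsf{inl}.\mathrm{id}_T,\ \mathtt{l}\triangleleft\mathsf{inr}.\mathrm{id}_S\}$. Isomorphism: $T\cong S$ iff there exist processes $A,B$ with $\vdash A\triangleright\mathtt{l}:\overline{T},\mathtt{r}:S$ and $\vdash B\triangleright\mathtt{l}:\overline{S},\mathtt{r}:T$ (empty environment) such that $A\bowtie B\approx\mathrm{id}_T$ and $B\bowtie A\approx\mathrm{id}_S$. -}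

module Defs where

open import Data.Nat using (ℕ; _≡ᵇ_)
open import Data.Integer using (ℤ)
open import Data.Bool using (Bool; true; false; if_then_else_)
open import Data.List using (List; []; _∷_)
open import Data.Maybe using (Maybe; just; nothing)
open import Data.Product using (_×_; _,_; ∃; Σ)
open import Data.Empty using (⊥)
open import Relation.Nullary using (¬_)
open import Relation.Binary.PropositionalEquality using (_≡_; _≢_)
open import Function.Bundles using (_⇔_)

data Chan : Set where
  l r : Chan

dualC : Chan → Chan
dualC l = r
dualC r = l

data Sel : Set where
  inl inr : Sel

data BType : Set where
  unit bool int : BType

data Value : Set where
  unitV : Value
  boolV : Bool → Value
  intV  : ℤ → Value

data _∈ᵥ_ : Value → BType → Set where
  unit∈ : unitV ∈ᵥ unit
  bool∈ : ∀ {b} → boolV b ∈ᵥ bool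
  int∈  : ∀ {z} → intV z ∈ᵥ int

Var : Set
Var = ℕ

data Expr : Set where
  var  : Var → Expr
  val  : Value → Expr
  _==_ : Expr → Expr → Expr

-- deterministic evaluation e ⇓ v (only closed expressions evaluate)
data _⇓_ : Expr → Value → Set where
  ⇓val   : ∀ {v} → val v ⇓ v
  ⇓eq-tt : ∀ {e₁ e₂ v₁ v₂} → e₁ ⇓ v₁ → e₂ ⇓ v₂ → v₁ ≡ v₂ → (e₁ == e₂) ⇓ boolV true
  ⇓eq-ff : ∀ {e₁ e₂ v₁ v₂} → e₁ ⇓ v₁ → e₂ ⇓ v₂ → v₁ ≢ v₂ → (e₁ == e₂) ⇓ boolV false

data Proc : Set where
  𝟎      : Proc
  inp    : Chan → Var → BType → Proc → Proc
  out    : Chan → Expr → Proc → Proc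
  sel    : Chan → Sel → Proc → Proc
  bra    : Chan → Proc → Proc → Proc
  ifte   : Expr → Proc → Proc → Proc
  _⋈_    : Proc → Proc → Proc

infixl 5 _⋈_

substE : Expr → Value → Var → Expr
substE (var y) v x = if x ≡ᵇ y then val v else var y
substE (val w) v x = val w
substE (e₁ == e₂) v x = substE e₁ v x == substE e₂ v x

substP : Proc → Value → Var → Proc
substP 𝟎 v x = 𝟎
substP (inp c y t P) v x = inp c y t (if x ≡ᵇ y then P else substP P v x)
substP (out c e P) v x = out c (substE e v x) (substP P v x)
substP (sel c ℓ P) v x = sel c ℓ (substP P v x)
substP (bra c P Q) v x = bra c (substP P v x) (substP Q v x)
substP (ifte e P Q) v x = ifte (substE e v x) (substP P v x) (substP Q v x)
substP (P ⋈ Q) v x = substP P v x ⋈ substP Q v x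

pick : Sel → Proc → Proc → Proc
pick inl P Q = P
pick inr P Q = Q

data _≡ₛ_ : Proc → Proc → Set where
  s-refl  : ∀ {P} → P ≡ₛ P
  s-sym   : ∀ {P Q} → P ≡ₛ Q → Q ≡ₛ P
  s-trans : ∀ {P Q R} → P ≡ₛ Q → Q ≡ₛ R → P ≡ₛ R
  s-inp   : ∀ {c x t P P'} → P ≡ₛ P' → inp c x t P ≡ₛ inp c x t P'
  s-out   : ∀ {c e P P'} → P ≡ₛ P' → out c e P ≡ₛ out c e P'
  s-sel   : ∀ {c ℓ P P'} → P ≡ₛ P' → sel c ℓ P ≡ₛ sel c ℓ P'
  s-bra   : ∀ {c P P' Q Q'} → P ≡ₛ P' → Q ≡ₛ Q' → bra c P Q ≡ₛ bra c P' Q'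
  s-if    : ∀ {e P P' Q Q'} → P ≡ₛ P' → Q ≡ₛ Q' → ifte e P Q ≡ₛ ifte e P' Q'
  s-par   : ∀ {P P' Q Q'} → P ≡ₛ P' → Q ≡ₛ Q' → (P ⋈ Q) ≡ₛ (P' ⋈ Q')
  s-unit  : (𝟎 ⋈ 𝟎) ≡ₛ 𝟎
  s-assoc : ∀ {P Q R} → ((P ⋈ Q) ⋈ R) ≡ₛ (P ⋈ (Q ⋈ R))

data RCtx : Set where
  hole : RCtx
  _⋈ₗ_ : RCtx → Proc → RCtx
  _⋈ᵣ_ : Proc → RCtx → RCtx

plug : RCtx → Proc → Proc
plug hole P = P
plug (C ⋈ₗ Q) P = plug C P ⋈ Q
plug (Q ⋈ᵣ C) P = Q ⋈ plug C P

data _⟶_ : Proc → Proc → Set where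
  r-comm₁ : ∀ {e P x t Q v} → e ⇓ v → v ∈ᵥ t →
            (out r e P ⋈ inp l x t Q) ⟶ (P ⋈ substP Q v x)
  r-comm₂ : ∀ {x t P e Q v} → e ⇓ v → v ∈ᵥ t →
            (inp r x t P ⋈ out l e Q) ⟶ (substP P v x ⋈ Q)
  r-sel₁  : ∀ {ℓ P Q₁ Q₂} → (sel r ℓ P ⋈ bra l Q₁ Q₂) ⟶ (P ⋈ pick ℓ Q₁ Q₂)
  r-sel₂  : ∀ {P₁ P₂ ℓ Q} → (bra r P₁ P₂ ⋈ sel l ℓ Q) ⟶ (pick ℓ P₁ P₂ ⋈ Q)
  r-if    : ∀ {e P Q b} → e ⇓ boolV b → ifte e P Q ⟶ (if b then P else Q)
  r-ctx   : ∀ C {P Q} → P ⟶ Q → plug C P ⟶ plug C Q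
  r-struct : ∀ {P P' Q' Q} → P ≡ₛ P' → P' ⟶ Q' → Q' ≡ₛ Q → P ⟶ Q

data _⟶*_ : Proc → Proc → Set where
  ε   : ∀ {P} → P ⟶* P
  _◅_ : ∀ {P Q R} → P ⟶ Q → Q ⟶* R → P ⟶* R

Stuck : Proc → Set
Stuck Q = ∀ R → ¬ (Q ⟶ R)

Correct : Proc → Set
Correct P = ∀ Q → P ⟶* Q → Stuck Q → Q ≡ₛ 𝟎

_≈_ : Proc → Proc → Set
P ≈ Q = ∀ (C : RCtx) → Correct (plug C P) ⇔ Correct (plug C Q)

data SType : Set where
  end  : SType
  ¿_∙_ : BType → SType → SType
  !_∙_ : BType → SType → SType
  _&_  : SType → SType → SType     -- T + S  (branching)
  _⊕_  : SType → SType → SType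

dual : SType → SType
dual end = end
dual (¿ t ∙ T) = ! t ∙ dual T
dual (! t ∙ T) = ¿ t ∙ dual T
dual (T & S) = dual T ⊕ dual S
dual (T ⊕ S) = dual T & dual S

-- c : T , c̄ : S  as the pair (type of l , type of r)
at : Chan → SType → SType → SType × SType
at l T S = T , S
at r T S = S , T

TEnv : Set
TEnv = List (Var × BType)

lookupV : TEnv → Var → Maybe BType
lookupV [] x = nothing
lookupV ((y , t) ∷ Γ) x = if x ≡ᵇ y then just t else lookupV Γ x

data _⊢ₑ_∶_ : TEnv → Expr → BType → Set where
  t-var : ∀ {Γ x t} → lookupV Γ x ≡ just t → Γ ⊢ₑ var x ∶ t
  t-val : ∀ {Γ v t} → v ∈ᵥ t → Γ ⊢ₑ val v ∶ t
  t-eq  : ∀ {Γ e₁ e₂ t} → Γ ⊢ₑ e₁ ∶ t → Γ ⊢ₑ e₂ ∶ t → Γ ⊢ₑ (e₁ == e₂) ∶ bool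

-- typing of processes: Γ ⊢ P ▷ (T , S)  means  l : T , r : S
data _⊢_▷_ : TEnv → Proc → SType × SType → Set where
  t-inp : ∀ {Γ c x t P T S} → ((x , t) ∷ Γ) ⊢ P ▷ at c T S →
          Γ ⊢ inp c x t P ▷ at c (¿ t ∙ T) S
  t-out : ∀ {Γ c e t P T S} → Γ ⊢ₑ e ∶ t → Γ ⊢ P ▷ at c T S →
          Γ ⊢ out c e P ▷ at c (! t ∙ T) S
  t-bra : ∀ {Γ c P₁ P₂ T₁ T₂ S} → Γ ⊢ P₁ ▷ at c T₁ S → Γ ⊢ P₂ ▷ at c T₂ S →
          Γ ⊢ bra c P₁ P₂ ▷ at c (T₁ & T₂) S
  t-inl : ∀ {Γ c P T₁ T₂ S} → Γ ⊢ P ▷ at c T₁ S →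
          Γ ⊢ sel c inl P ▷ at c (T₁ ⊕ T₂) S
  t-inr : ∀ {Γ c P T₁ T₂ S} → Γ ⊢ P ▷ at c T₂ S →
          Γ ⊢ sel c inr P ▷ at c (T₁ ⊕ T₂) S
  t-nil : ∀ {Γ} → Γ ⊢ 𝟎 ▷ (end , end)
  t-if  : ∀ {Γ e P₁ P₂ T S} → Γ ⊢ₑ e ∶ bool → Γ ⊢ P₁ ▷ (T , S) → Γ ⊢ P₂ ▷ (T , S) →
          Γ ⊢ ifte e P₁ P₂ ▷ (T , S)
  t-par : ∀ {Γ P Q T T' S} → Γ ⊢ P ▷ (T , T') → Γ ⊢ Q ▷ (dual T' , S) →
          Γ ⊢ (P ⋈ Q) ▷ (T , S)

-- identity processes (the bound variable name is fixed to 0)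

idP : SType → Proc
idP end = 𝟎
idP (! t ∙ T) = inp l 0 t (out r (var 0) (idP T))
idP (¿ t ∙ T) = inp r 0 t (out l (var 0) (idP T))
idP (T ⊕ S) = bra l (sel r inl (idP T)) (sel r inr (idP S))
idP (T & S) = bra r (sel l inl (idP T)) (sel l inr (idP S))

_≅_ : SType → SType → Set
T ≅ S = Σ Proc λ A → Σ Proc λ B →
          ([] ⊢ A ▷ (dual T , S)) × ([] ⊢ B ▷ (dual S , T)) ×
          ((A ⋈ B) ≈ idP T) × ((B ⋈ A) ≈ idP S)

-- Each law T ≅ S is witnessed by explicit forwarders A and B built around the
-- identity processes idP; their typings are immediate, and the content lies in
-- A ⋈ B ≈ idP T and B ⋈ A ≈ idP S.  To prove such equivalences a process is
-- flattened into the list of its ⋈-components.  There, a reduction is a step of a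
-- single component or a synchronisation of two neighbours on facing channels; it
-- is confluent and strictly decreases the size, so correctness is invariant under
-- reduction and equivalence of components in all contexts (≈ᶠ) follows from
-- up-to arguments.  These give a small calculus: ≈ᶠ is a congruence for prefixes,
-- a component that first acts away from a neighbour can absorb it into its
-- continuation, an l-action and an r-action of one component commute, and
-- idP T ⋈ idP T ≈ᶠ idP T.  Canonical forms, which collapse runs of 𝟎, turn
-- structural congruence into equality and so transfer ≈ᶠ to ≈.  Finally,
-- exchanging l and r maps idP T to idP (dual T) and preserves reduction, hence
-- T ≅ S implies dual T ≅ dual S, and (a2), (a4), …, (a12) are the duals of
-- (a1), (a3), …, (a11).

module Submission where

open import Defs
open import Data.Bool using (Bool; true; false; if_then_else_)
import Data.Bool as B
import Data.Integer as Z
open import Data.Empty using (⊥; ⊥-elim)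
open import Data.List using (List; []; _∷_; _++_; [_]; map)
open import Data.List.Properties using (++-assoc; ++-identityʳ; map-++; ∷-injective; map-∘)
open import Data.List.Relation.Unary.All using (All; []; _∷_; head; tail)
open import Data.List.Relation.Unary.All.Properties using (++⁺; ++⁻)
open import Data.Nat using (ℕ; zero; suc; _≡ᵇ_; _+_; _<_; _≤_; s≤s; s≤s⁻¹)
open import Data.Nat.Properties using (≤-refl; <-≤-trans; ≤-<-trans; m≤m+n; m≤n+m; +-mono-<-≤; +-mono-≤-<; +-mono-≤; +-assoc; <⇒≤; +-identityʳ)
open import Data.Product using (Σ; _×_; _,_; proj₁; proj₂)
open import Data.Sum using (_⊎_; inj₁; inj₂)
open import Data.Unit using (⊤; tt)
open import Function.Bundles using (_⇔_; mk⇔; Equivalence)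
import Function.Properties.Equivalence as ⇔
open import Relation.Nullary using (¬_; Dec; yes; no)
open import Relation.Binary.PropositionalEquality hiding ([_])
open import Relation.Binary.Construct.Closure.ReflexiveTransitive as Star using (Star; _◅◅_) renaming (ε to done; _◅_ to _∷s_)

_≟ᵥ_ : (v w : Value) → Dec (v ≡ w)
unitV ≟ᵥ unitV = yes refl
unitV ≟ᵥ boolV x = no λ ()
unitV ≟ᵥ intV x = no λ ()
boolV x ≟ᵥ unitV = no λ ()
boolV x ≟ᵥ boolV y with x B.≟ y
... | yes refl = yes refl
... | no ne = no λ { refl → ne refl }
boolV x ≟ᵥ intV y = no λ ()
intV x ≟ᵥ unitV = no λ ()
intV x ≟ᵥ boolV y = no λ ()
intV x ≟ᵥ intV y with x Z.≟ y
... | yes refl = yes refl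
... | no ne = no λ { refl → ne refl }

eval? : (e : Expr) → (Σ Value (e ⇓_)) ⊎ (∀ v → ¬ e ⇓ v)
eval? (var x) = inj₂ (λ v ())
eval? (val v) = inj₁ (v , ⇓val)
eval? (e₁ == e₂) with eval? e₁ | eval? e₂
... | inj₁ (v₁ , d₁) | inj₁ (v₂ , d₂) with v₁ ≟ᵥ v₂
...   | yes eq = inj₁ (_ , ⇓eq-tt d₁ d₂ eq)
...   | no ne = inj₁ (_ , ⇓eq-ff d₁ d₂ ne)
eval? (e₁ == e₂) | inj₂ n | _ = inj₂ λ { v (⇓eq-tt d _ _) → n _ d ; v (⇓eq-ff d _ _) → n _ d }
eval? (e₁ == e₂) | inj₁ _ | inj₂ n = inj₂ λ { v (⇓eq-tt _ d _) → n _ d ; v (⇓eq-ff _ d _) → n _ d }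

⇓-det : ∀ {e v w} → e ⇓ v → e ⇓ w → v ≡ w
⇓-det ⇓val ⇓val = refl
⇓-det (⇓eq-tt a b eq) (⇓eq-tt a' b' eq') = refl
⇓-det (⇓eq-tt a b eq) (⇓eq-ff a' b' ne) = ⊥-elim (ne (trans (sym (⇓-det a a')) (trans eq (⇓-det b b'))))
⇓-det (⇓eq-ff a b ne) (⇓eq-tt a' b' eq) = ⊥-elim (ne (trans (⇓-det a a') (trans eq (sym (⇓-det b b')))))
⇓-det (⇓eq-ff a b ne) (⇓eq-ff a' b' ne') = refl

∈ᵥ? : (v : Value) (t : BType) → Dec (v ∈ᵥ t)
∈ᵥ? unitV unit = yes unit∈
∈ᵥ? unitV bool = no λ ()
∈ᵥ? unitV int = no λ ()
∈ᵥ? (boolV x) unit = no λ ()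
∈ᵥ? (boolV x) bool = yes bool∈
∈ᵥ? (boolV x) int = no λ ()
∈ᵥ? (intV x) unit = no λ ()
∈ᵥ? (intV x) bool = no λ ()
∈ᵥ? (intV x) int = yes int∈

-- Configurations and their reduction

flat : Proc → List Proc
flat (P ⋈ Q) = flat P ++ flat Q
flat 𝟎 = [ 𝟎 ]
flat (inp c x t P) = [ inp c x t P ]
flat (out c e P) = [ out c e P ]
flat (sel c s P) = [ sel c s P ]
flat (bra c P Q) = [ bra c P Q ]
flat (ifte e P Q) = [ ifte e P Q ]

data Label : Set where
  snd rcv : Value → Label
  sl br : Sel → Label

dualLabel : Label → Label
dualLabel (snd v) = rcv v
dualLabel (rcv v) = snd v
dualLabel (sl s) = br s
dualLabel (br s) = sl s

data Tr : Proc → Chan → Label → List Proc → Set where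
  tr-in  : ∀ {c x t P v} → v ∈ᵥ t → Tr (inp c x t P) c (rcv v) (flat (substP P v x))
  tr-out : ∀ {c e P v} → e ⇓ v → Tr (out c e P) c (snd v) (flat P)
  tr-sel : ∀ {c s P} → Tr (sel c s P) c (sl s) (flat P)
  tr-bra : ∀ {c s P Q} → Tr (bra c P Q) c (br s) (flat (pick s P Q))

data Tau : Proc → List Proc → Set where
  tau-if : ∀ {e P Q b} → e ⇓ boolV b → Tau (ifte e P Q) (flat (if b then P else Q))

infix 4 _⟶ᶠ_ _⟶ᶠ*_
data _⟶ᶠ_ : List Proc → List Proc → Set where
  sync : ∀ {a b μ ca cb xs} → Tr a r μ ca → Tr b l (dualLabel μ) cb → (a ∷ b ∷ xs) ⟶ᶠ (ca ++ cb ++ xs)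
  silent : ∀ {a ca xs} → Tau a ca → (a ∷ xs) ⟶ᶠ (ca ++ xs)
  there : ∀ {a xs ys} → xs ⟶ᶠ ys → (a ∷ xs) ⟶ᶠ (a ∷ ys)

_⟶ᶠ*_ : List Proc → List Proc → Set
_⟶ᶠ*_ = Star _⟶ᶠ_

Stuckᶠ : List Proc → Set
Stuckᶠ xs = ∀ ys → ¬ (xs ⟶ᶠ ys)

All𝟎 : List Proc → Set
All𝟎 = All (_≡ 𝟎)

Correctᶠ : List Proc → Set
Correctᶠ xs = ∀ ys → xs ⟶ᶠ* ys → Stuckᶠ ys → All𝟎 ys

Tr-Tau-disjoint : ∀ {a c μ ca cb} → Tr a c μ ca → Tau a cb → ⊥
Tr-Tau-disjoint (tr-in x) ()
Tr-Tau-disjoint (tr-out x) ()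
Tr-Tau-disjoint tr-sel ()
Tr-Tau-disjoint tr-bra ()

Tr-chan-unique : ∀ {a c c' μ μ' ca cb} → Tr a c μ ca → Tr a c' μ' cb → c ≡ c'
Tr-chan-unique (tr-in x) (tr-in y) = refl
Tr-chan-unique (tr-out x) (tr-out y) = refl
Tr-chan-unique tr-sel tr-sel = refl
Tr-chan-unique tr-bra tr-bra = refl

Tau-det : ∀ {a ca cb} → Tau a ca → Tau a cb → ca ≡ cb
Tau-det (tau-if d) (tau-if d') with ⇓-det d d'
... | refl = refl

sync-det : ∀ {a b μ μ' ca cb ca' cb'} → Tr a r μ ca → Tr b l (dualLabel μ) cb →
          Tr a r μ' ca' → Tr b l (dualLabel μ') cb' → (ca ≡ ca') × (cb ≡ cb')
sync-det (tr-in m) (tr-out d) (tr-in m') (tr-out d') with ⇓-det d d'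
... | refl = refl , refl
sync-det (tr-out d) (tr-in m) (tr-out d') (tr-in m') with ⇓-det d d'
... | refl = refl , refl
sync-det tr-sel tr-bra tr-sel tr-bra = refl , refl
sync-det tr-bra tr-sel tr-bra tr-sel = refl , refl

l≢r : l ≡ r → ⊥
l≢r ()

_▸≡_ : ∀ {xs ys ys'} → xs ⟶ᶠ ys → ys ≡ ys' → xs ⟶ᶠ ys'
s ▸≡ refl = s

_≡▸_ : ∀ {xs xs' ys} → xs ≡ xs' → xs' ⟶ᶠ ys → xs ⟶ᶠ ys
refl ≡▸ s = s

prefix-step : ∀ pre {xs ys} → xs ⟶ᶠ ys → (pre ++ xs) ⟶ᶠ (pre ++ ys)
prefix-step [] s = s
prefix-step (a ∷ pre) s = there (prefix-step pre s)

suffix-step : ∀ {xs ys} → xs ⟶ᶠ ys → ∀ post → (xs ++ post) ⟶ᶠ (ys ++ post)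
suffix-step (sync {ca = ca} {cb} {xs} t1 t2) post =
  sync t1 t2 ▸≡ trans (cong (ca ++_) (sym (++-assoc cb xs post))) (sym (++-assoc ca (cb ++ xs) post))
suffix-step (silent {ca = ca} {xs} τ) post = silent τ ▸≡ sym (++-assoc ca xs post)
suffix-step (there s) post = there (suffix-step s post)

prefix-run : ∀ pre {xs ys} → xs ⟶ᶠ* ys → (pre ++ xs) ⟶ᶠ* (pre ++ ys)
prefix-run pre = Star.gmap (pre ++_) (prefix-step pre)

suffix-run : ∀ {xs ys} → xs ⟶ᶠ* ys → ∀ post → (xs ++ post) ⟶ᶠ* (ys ++ post)
suffix-run run post = Star.gmap (_++ post) (λ s → suffix-step s post) run

diamond : ∀ {xs ys zs} → xs ⟶ᶠ ys → xs ⟶ᶠ zs → ys ≡ zs ⊎ Σ _ (λ ws → (ys ⟶ᶠ ws) × (zs ⟶ᶠ ws))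
diamond (sync t1 t2) (sync t1' t2') with sync-det t1 t2 t1' t2'
... | refl , refl = inj₁ refl
diamond (sync t1 t2) (silent τ) = ⊥-elim (Tr-Tau-disjoint t1 τ)
diamond (sync t1 t2) (there (sync u1 u2)) = ⊥-elim (l≢r (Tr-chan-unique t2 u1))
diamond (sync t1 t2) (there (silent τ)) = ⊥-elim (Tr-Tau-disjoint t2 τ)
diamond (sync {ca = ca} {cb} t1 t2) (there (there s)) = inj₂ (_ , prefix-step ca (prefix-step cb s) , sync t1 t2)
diamond (silent τ) (sync t1 t2) = ⊥-elim (Tr-Tau-disjoint t1 τ)
diamond (silent τ) (silent τ') with Tau-det τ τ'
... | refl = inj₁ refl
diamond (silent {ca = ca} τ) (there s) = inj₂ (_ , prefix-step ca s , silent τ)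
diamond (there (sync u1 u2)) (sync t1 t2) = ⊥-elim (l≢r (Tr-chan-unique t2 u1))
diamond (there (silent τ)) (sync t1 t2) = ⊥-elim (Tr-Tau-disjoint t2 τ)
diamond (there (there s)) (sync {ca = ca} {cb} t1 t2) = inj₂ (_ , sync t1 t2 , prefix-step ca (prefix-step cb s))
diamond (there s) (silent {ca = ca} τ) = inj₂ (_ , silent τ , prefix-step ca s)
diamond (there s) (there s') with diamond s s'
... | inj₁ refl = inj₁ refl
... | inj₂ (ws , p , q) = inj₂ (_ ∷ ws , there p , there q)

size : Proc → ℕ
size 𝟎 = 0
size (inp c x t P) = suc (size P)
size (out c e P) = suc (size P)
size (sel c s P) = suc (size P)
size (bra c P Q) = suc (size P + size Q)
size (ifte e P Q) = suc (size P + size Q)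
size (P ⋈ Q) = size P + size Q

sizes : List Proc → ℕ
sizes [] = 0
sizes (a ∷ as) = size a + sizes as

sizes-++ : ∀ xs ys → sizes (xs ++ ys) ≡ sizes xs + sizes ys
sizes-++ [] ys = refl
sizes-++ (a ∷ xs) ys = trans (cong (size a +_) (sizes-++ xs ys)) (sym (+-assoc (size a) (sizes xs) (sizes ys)))

sizes-flat : ∀ P → sizes (flat P) ≡ size P
sizes-flat 𝟎 = refl
sizes-flat (inp c x t P) = cong suc (+-identityʳ (size P))
sizes-flat (out c e P) = cong suc (+-identityʳ (size P))
sizes-flat (sel c s P) = cong suc (+-identityʳ (size P))
sizes-flat (bra c P Q) = cong suc (+-identityʳ _)
sizes-flat (ifte e P Q) = cong suc (+-identityʳ _)
sizes-flat (P ⋈ Q) = trans (sizes-++ (flat P) (flat Q)) (cong₂ _+_ (sizes-flat P) (sizes-flat Q))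

size-subst : ∀ P v x → size (substP P v x) ≡ size P
size-subst 𝟎 v x = refl
size-subst (inp c y t P) v x with x ≡ᵇ y
... | true = refl
... | false = cong suc (size-subst P v x)
size-subst (out c e P) v x = cong suc (size-subst P v x)
size-subst (sel c s P) v x = cong suc (size-subst P v x)
size-subst (bra c P Q) v x = cong suc (cong₂ _+_ (size-subst P v x) (size-subst Q v x))
size-subst (ifte e P Q) v x = cong suc (cong₂ _+_ (size-subst P v x) (size-subst Q v x))
size-subst (P ⋈ Q) v x = cong₂ _+_ (size-subst P v x) (size-subst Q v x)

size-pick : ∀ s P Q → size (pick s P Q) ≤ size P + size Q
size-pick inl P Q = m≤m+n (size P) (size Q)
size-pick inr P Q = m≤n+m (size Q) (size P)

size-if : ∀ (b : Bool) P Q → size (if b then P else Q) ≤ size P + size Q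
size-if true P Q = m≤m+n (size P) (size Q)
size-if false P Q = m≤n+m (size Q) (size P)

Tr-shrinks : ∀ {a c μ ca} → Tr a c μ ca → sizes ca < size a
Tr-shrinks (tr-in {x = x} {P = P} {v = v} m) rewrite sizes-flat (substP P v x) | size-subst P v x = ≤-refl
Tr-shrinks (tr-out {P = P} d) rewrite sizes-flat P = ≤-refl
Tr-shrinks (tr-sel {P = P}) rewrite sizes-flat P = ≤-refl
Tr-shrinks (tr-bra {s = s} {P} {Q}) rewrite sizes-flat (pick s P Q) = s≤s (size-pick s P Q)

Tau-shrinks : ∀ {a ca} → Tau a ca → sizes ca < size a
Tau-shrinks (tau-if {P = P} {Q} {b} d) rewrite sizes-flat (if b then P else Q) = s≤s (size-if b P Q)

step-shrinks : ∀ {xs ys} → xs ⟶ᶠ ys → sizes ys < sizes xs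
step-shrinks (sync {a = a} {b} {ca = ca} {cb} {xs} t1 t2)
  rewrite sizes-++ ca (cb ++ xs) | sizes-++ cb xs =
  +-mono-<-≤ (Tr-shrinks t1) (<⇒≤ (+-mono-<-≤ (Tr-shrinks t2) ≤-refl))
step-shrinks (silent {ca = ca} {xs} τ) rewrite sizes-++ ca xs = +-mono-<-≤ (Tau-shrinks τ) ≤-refl
step-shrinks (there {a = a} s) = +-mono-≤-< (≤-refl {size a}) (step-shrinks s)

Correctᶠ-step : ∀ {xs ys} → Correctᶠ xs → xs ⟶ᶠ ys → Correctᶠ ys
Correctᶠ-step c s zs run st = c zs (s ∷s run) st

-- Backwards preservation rests on the diamond property; n is fuel bounding the size.
Correctᶠ-unstep : ∀ n {xs ys} → sizes xs < n → xs ⟶ᶠ ys → Correctᶠ ys → Correctᶠ xs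
Correctᶠ-unstep (suc n) lt s cy zs done st = ⊥-elim (st _ s)
Correctᶠ-unstep (suc n) lt s cy zs (s' ∷s run) st with diamond s s'
... | inj₁ refl = cy zs run st
... | inj₂ (ws , p , q) = Correctᶠ-unstep n (<-≤-trans (step-shrinks s') (s≤s⁻¹ lt)) q (Correctᶠ-step cy p) zs run st

step-Correctᶠ : ∀ {xs ys} → xs ⟶ᶠ ys → Correctᶠ xs ⇔ Correctᶠ ys
step-Correctᶠ s = mk⇔ (λ c → Correctᶠ-step c s) (Correctᶠ-unstep _ ≤-refl s)

run-Correctᶠ : ∀ {xs ys} → xs ⟶ᶠ* ys → Correctᶠ xs ⇔ Correctᶠ ys
run-Correctᶠ done = ⇔.refl
run-Correctᶠ (s ∷s p) = ⇔.trans (step-Correctᶠ s) (run-Correctᶠ p)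

data Move (R : List Proc → List Proc → Set) (xs ys : List Proc) : Set where
  left : ∀ {xs'} → xs ⟶ᶠ xs' → R xs' ys → Move R xs ys
  right : ∀ {ys'} → ys ⟶ᶠ ys' → R xs ys' → Move R xs ys
  both : ∀ {xs' ys'} → xs ⟶ᶠ xs' → ys ⟶ᶠ ys' → R xs' ys' → Move R xs ys
  decided : Correctᶠ xs ⇔ Correctᶠ ys → Move R xs ys

up-to′ : (R : List Proc → List Proc → Set) → (∀ {xs ys} → R xs ys → Move R xs ys) →
        ∀ n {xs ys} → sizes xs + sizes ys < n → R xs ys → Correctᶠ xs ⇔ Correctᶠ ys
up-to′ R move (suc n) lt rel with move rel
... | left s rel' = ⇔.trans (step-Correctᶠ s)
       (up-to′ R move n (<-≤-trans (+-mono-<-≤ (step-shrinks s) ≤-refl) (s≤s⁻¹ lt)) rel')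
... | right s rel' = ⇔.trans
       (up-to′ R move n (<-≤-trans (+-mono-≤-< ≤-refl (step-shrinks s)) (s≤s⁻¹ lt)) rel')
       (⇔.sym (step-Correctᶠ s))
... | both s s' rel' = ⇔.trans (step-Correctᶠ s) (⇔.trans
       (up-to′ R move n (<-≤-trans (≤-<-trans (+-mono-≤ (<⇒≤ (step-shrinks s)) ≤-refl) (+-mono-≤-< ≤-refl (step-shrinks s'))) (s≤s⁻¹ lt)) rel')
       (⇔.sym (step-Correctᶠ s')))
... | decided e = e

up-to : (R : List Proc → List Proc → Set) → (∀ {xs ys} → R xs ys → Move R xs ys) →
       ∀ {xs ys} → R xs ys → Correctᶠ xs ⇔ Correctᶠ ys
up-to R move rel = up-to′ R move _ ≤-refl rel

data RightAction : Proc → Set where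
  pOut : ∀ e P → RightAction (out r e P)
  pInp : ∀ x t P → RightAction (inp r x t P)
  pSel : ∀ s P → RightAction (sel r s P)
  pBra : ∀ P Q → RightAction (bra r P Q)
  pNone : ∀ {a} → (∀ μ ca → ¬ Tr a r μ ca) → RightAction a

rightAction : (a : Proc) → RightAction a
rightAction 𝟎 = pNone λ μ ca ()
rightAction (inp l x t P) = pNone λ μ ca ()
rightAction (inp r x t P) = pInp x t P
rightAction (out l e P) = pNone λ μ ca ()
rightAction (out r e P) = pOut e P
rightAction (sel l s P) = pNone λ μ ca ()
rightAction (sel r s P) = pSel s P
rightAction (bra l P Q) = pNone λ μ ca ()
rightAction (bra r P Q) = pBra P Q
rightAction (ifte e P Q) = pNone λ μ ca ()
rightAction (P ⋈ Q) = pNone λ μ ca ()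

data LeftAction : Proc → Set where
  qOut : ∀ e P → LeftAction (out l e P)
  qInp : ∀ x t P → LeftAction (inp l x t P)
  qSel : ∀ s P → LeftAction (sel l s P)
  qBra : ∀ P Q → LeftAction (bra l P Q)
  qNone : ∀ {a} → (∀ μ ca → ¬ Tr a l μ ca) → LeftAction a

leftAction : (a : Proc) → LeftAction a
leftAction 𝟎 = qNone λ μ ca ()
leftAction (inp l x t P) = qInp x t P
leftAction (inp r x t P) = qNone λ μ ca ()
leftAction (out l e P) = qOut e P
leftAction (out r e P) = qNone λ μ ca ()
leftAction (sel l s P) = qSel s P
leftAction (sel r s P) = qNone λ μ ca ()
leftAction (bra l P Q) = qBra P Q
leftAction (bra r P Q) = qNone λ μ ca ()
leftAction (ifte e P Q) = qNone λ μ ca ()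
leftAction (P ⋈ Q) = qNone λ μ ca ()

Syncs : Proc → Proc → Set
Syncs a b = Σ Label λ μ → Σ (List Proc) λ ca → Σ (List Proc) λ cb → Tr a r μ ca × Tr b l (dualLabel μ) cb

sync-out-inp? : ∀ e P x t Q → Syncs (out r e P) (inp l x t Q) ⊎ ¬ Syncs (out r e P) (inp l x t Q)
sync-out-inp? e P x t Q with eval? e
... | inj₂ n = inj₂ λ { (_ , _ , _ , tr-out d , _) → n _ d }
... | inj₁ (v , d) with ∈ᵥ? v t
...   | yes m = inj₁ (_ , _ , _ , tr-out d , tr-in m)
...   | no nm = inj₂ λ { (_ , _ , _ , tr-out d' , tr-in m) → nm (subst (_∈ᵥ t) (⇓-det d' d) m) }

sync-inp-out? : ∀ x t P e Q → Syncs (inp r x t P) (out l e Q) ⊎ ¬ Syncs (inp r x t P) (out l e Q)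
sync-inp-out? x t P e Q with eval? e
... | inj₂ n = inj₂ λ { (_ , _ , _ , tr-in m , tr-out d) → n _ d }
... | inj₁ (v , d) with ∈ᵥ? v t
...   | yes m = inj₁ (_ , _ , _ , tr-in m , tr-out d)
...   | no nm = inj₂ λ { (_ , _ , _ , tr-in m , tr-out d') → nm (subst (_∈ᵥ t) (⇓-det d' d) m) }

sync? : (a b : Proc) → Syncs a b ⊎ ¬ Syncs a b
sync? a b with rightAction a | leftAction b
... | pNone n | _ = inj₂ λ { (_ , _ , _ , t1 , _) → n _ _ t1 }
... | pOut e P | qInp x t Q = sync-out-inp? e P x t Q
... | pInp x t P | qOut e Q = sync-inp-out? x t P e Q
... | pSel s P | qBra Q₁ Q₂ = inj₁ (_ , _ , _ , tr-sel , tr-bra)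
... | pBra P₁ P₂ | qSel s Q = inj₁ (_ , _ , _ , tr-bra , tr-sel)
... | pOut _ _ | qNone n = inj₂ λ { (_ , _ , _ , _ , t2) → n _ _ t2 }
... | pInp _ _ _ | qNone n = inj₂ λ { (_ , _ , _ , _ , t2) → n _ _ t2 }
... | pSel _ _ | qNone n = inj₂ λ { (_ , _ , _ , _ , t2) → n _ _ t2 }
... | pBra _ _ | qNone n = inj₂ λ { (_ , _ , _ , _ , t2) → n _ _ t2 }
... | pOut _ _ | qOut _ _ = inj₂ λ { (_ , _ , _ , tr-out _ , ()) }
... | pOut _ _ | qSel _ _ = inj₂ λ { (_ , _ , _ , tr-out _ , ()) }
... | pOut _ _ | qBra _ _ = inj₂ λ { (_ , _ , _ , tr-out _ , ()) }
... | pInp _ _ _ | qInp _ _ _ = inj₂ λ { (_ , _ , _ , tr-in _ , ()) }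
... | pInp _ _ _ | qSel _ _ = inj₂ λ { (_ , _ , _ , tr-in _ , ()) }
... | pInp _ _ _ | qBra _ _ = inj₂ λ { (_ , _ , _ , tr-in _ , ()) }
... | pSel _ _ | qOut _ _ = inj₂ λ { (_ , _ , _ , tr-sel , ()) }
... | pSel _ _ | qInp _ _ _ = inj₂ λ { (_ , _ , _ , tr-sel , ()) }
... | pSel _ _ | qSel _ _ = inj₂ λ { (_ , _ , _ , tr-sel , ()) }
... | pBra _ _ | qOut _ _ = inj₂ λ { (_ , _ , _ , tr-bra , ()) }
... | pBra _ _ | qInp _ _ _ = inj₂ λ { (_ , _ , _ , tr-bra , ()) }
... | pBra _ _ | qBra _ _ = inj₂ λ { (_ , _ , _ , tr-bra , ()) }

silent? : (a : Proc) → Σ _ (Tau a) ⊎ (∀ ca → ¬ Tau a ca)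
silent? (ifte e P Q) with eval? e
... | inj₂ n = inj₂ λ { ca (tau-if d) → n _ d }
... | inj₁ (boolV b , d) = inj₁ (_ , tau-if d)
... | inj₁ (unitV , d) = inj₂ λ { ca (tau-if d') → uv (⇓-det d d') }
  where uv : ∀ {b} → unitV ≡ boolV b → ⊥
        uv ()
... | inj₁ (intV z , d) = inj₂ λ { ca (tau-if d') → iv (⇓-det d d') }
  where iv : ∀ {b} → intV z ≡ boolV b → ⊥
        iv ()
silent? 𝟎 = inj₂ λ ca ()
silent? (inp c x t P) = inj₂ λ ca ()
silent? (out c e P) = inj₂ λ ca ()
silent? (sel c s P) = inj₂ λ ca ()
silent? (bra c P Q) = inj₂ λ ca ()
silent? (P ⋈ Q) = inj₂ λ ca ()

progress : ∀ xs → Σ _ (xs ⟶ᶠ_) ⊎ Stuckᶠ xs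
progress [] = inj₂ λ ys ()
progress (a ∷ []) with silent? a
... | inj₁ (ca , τ) = inj₁ (_ , silent τ)
... | inj₂ nτ = inj₂ λ { ys (silent τ) → nτ _ τ ; ys (there ()) }
progress (a ∷ b ∷ xs) with silent? a | sync? a b | progress (b ∷ xs)
... | inj₁ (ca , τ) | _ | _ = inj₁ (_ , silent τ)
... | inj₂ nτ | inj₁ (μ , ca , cb , t1 , t2) | _ = inj₁ (_ , sync t1 t2)
... | inj₂ nτ | inj₂ np | inj₁ (ys , s) = inj₁ (_ , there s)
... | inj₂ nτ | inj₂ np | inj₂ st = inj₂ λ { ys (sync t1 t2) → np (_ , _ , _ , t1 , t2) ; ys (silent τ) → nτ _ τ ; ys (there s) → st _ s }

data Split (A ys zs : List Proc) : Set where
  inPrefix : ∀ {A'} → A ⟶ᶠ A' → zs ≡ A' ++ ys → Split A ys zs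
  inSuffix : ∀ {ys'} → ys ⟶ᶠ ys' → zs ≡ A ++ ys' → Split A ys zs
  across : ∀ {A₀ a b ys₀ μ ca cb} → A ≡ A₀ ++ [ a ] → ys ≡ b ∷ ys₀ → Tr a r μ ca → Tr b l (dualLabel μ) cb →
        zs ≡ A₀ ++ ca ++ cb ++ ys₀ → Split A ys zs

split : ∀ A {ys zs} → (A ++ ys) ⟶ᶠ zs → Split A ys zs
split [] s = inSuffix s refl
split (a ∷ []) {[]} (silent {ca = ca} τ) = inPrefix (silent τ) (sym (++-identityʳ (ca ++ [])))
split (a ∷ []) {[]} (there ())
split (a ∷ []) {b ∷ ys} (sync t1 t2) = across {A₀ = []} refl refl t1 t2 refl
split (a ∷ []) {b ∷ ys} (silent {ca = ca} τ) = inPrefix (silent τ) (sym (++-assoc ca [] (b ∷ ys)))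
split (a ∷ []) {b ∷ ys} (there s) = inSuffix s refl
split (a ∷ b ∷ A) {ys} (sync {ca = ca} {cb} t1 t2) = inPrefix (sync t1 t2)
  (trans (cong (ca ++_) (sym (++-assoc cb A ys))) (sym (++-assoc ca (cb ++ A) ys)))
split (a ∷ b ∷ A) {ys} (silent {ca = ca} τ) = inPrefix (silent τ) (sym (++-assoc ca (b ∷ A) ys))
split (a ∷ b ∷ A) (there s) with split (b ∷ A) s
... | inPrefix s' eq = inPrefix (there s') (cong (a ∷_) eq)
... | inSuffix s' eq = inSuffix s' (cong (a ∷_) eq)
... | across eqA eqy t1 t2 eqz = across (cong (a ∷_) eqA) eqy t1 t2 (cong (a ∷_) eqz)

data StepAt (A : List Proc) (k : Proc) (B : List Proc) (zs : List Proc) : Set where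
  inLeft  : ∀ {A'} → A ⟶ᶠ A' → zs ≡ A' ++ k ∷ B → StepAt A k B zs
  syncLeft : ∀ {A₀ a μ ca ck} → A ≡ A₀ ++ [ a ] → Tr a r μ ca → Tr k l (dualLabel μ) ck →
        zs ≡ A₀ ++ ca ++ ck ++ B → StepAt A k B zs
  silentMid  : ∀ {ck} → Tau k ck → zs ≡ A ++ ck ++ B → StepAt A k B zs
  syncRight : ∀ {b B₀ μ ck cb} → B ≡ b ∷ B₀ → Tr k r μ ck → Tr b l (dualLabel μ) cb →
        zs ≡ A ++ ck ++ cb ++ B₀ → StepAt A k B zs
  inRight  : ∀ {B'} → B ⟶ᶠ B' → zs ≡ A ++ k ∷ B' → StepAt A k B zs

stepAt : ∀ A k B {zs} → (A ++ k ∷ B) ⟶ᶠ zs → StepAt A k B zs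
stepAt A k B s with split A s
... | inPrefix s' eq = inLeft s' eq
... | across eqA refl t1 t2 eqz = syncLeft eqA t1 t2 eqz
... | inSuffix (sync t1 t2) eq = syncRight refl t1 t2 eq
... | inSuffix (silent τ) eq = silentMid τ eq
... | inSuffix (there s') eq = inRight s' eq

step-inLeft : ∀ {A A'} k B → A ⟶ᶠ A' → (A ++ k ∷ B) ⟶ᶠ (A' ++ k ∷ B)
step-inLeft k B s = suffix-step s (k ∷ B)

step-syncLeft : ∀ {A A₀ a μ ca ck} k B → A ≡ A₀ ++ [ a ] → Tr a r μ ca → Tr k l (dualLabel μ) ck →
      (A ++ k ∷ B) ⟶ᶠ (A₀ ++ ca ++ ck ++ B)
step-syncLeft {A₀ = A₀} {a} k B refl t1 t2 = ++-assoc A₀ [ a ] (k ∷ B) ≡▸ prefix-step A₀ (sync t1 t2)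

step-silentMid : ∀ A {k ck} B → Tau k ck → (A ++ k ∷ B) ⟶ᶠ (A ++ ck ++ B)
step-silentMid A B τ = prefix-step A (silent τ)

step-syncRight : ∀ A {k B b B₀ μ ck cb} → B ≡ b ∷ B₀ → Tr k r μ ck → Tr b l (dualLabel μ) cb →
      (A ++ k ∷ B) ⟶ᶠ (A ++ ck ++ cb ++ B₀)
step-syncRight A refl t1 t2 = prefix-step A (sync t1 t2)

step-inRight : ∀ A k {B B'} → B ⟶ᶠ B' → (A ++ k ∷ B) ⟶ᶠ (A ++ k ∷ B')
step-inRight A k s = prefix-step A (there s)

All𝟎-middle : ∀ A {k B} → All𝟎 (A ++ k ∷ B) → k ≡ 𝟎
All𝟎-middle [] (p ∷ _) = p
All𝟎-middle (a ∷ A) (_ ∷ ps) = All𝟎-middle A ps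

blocked-suffix-¬Correctᶠ′ : ∀ {o B} → Stuckᶠ (o ∷ B) → (∀ μ c → ¬ Tr o l μ c) → ¬ o ≡ 𝟎 →
         ∀ n A → sizes A < n → ¬ Correctᶠ (A ++ o ∷ B)
blocked-suffix-¬Correctᶠ′ {o} {B} st nl nz (suc n) A lt c with progress (A ++ o ∷ B)
... | inj₂ st' = nz (All𝟎-middle A (c _ done st'))
... | inj₁ (zs , s) with stepAt A o B s
...   | inLeft s' refl = blocked-suffix-¬Correctᶠ′ st nl nz n _ (<-≤-trans (step-shrinks s') (s≤s⁻¹ lt)) (Correctᶠ-step c s)
...   | syncLeft eqA t1 t2 eq = nl _ _ t2
...   | silentMid τ eq = st _ (silent τ)
...   | syncRight refl t1 t2 eq = st _ (sync t1 t2)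
...   | inRight s' eq = st _ (there s')

blocked-suffix-¬Correctᶠ : ∀ {o B} → Stuckᶠ (o ∷ B) → (∀ μ c → ¬ Tr o l μ c) → ¬ o ≡ 𝟎 → ∀ A → ¬ Correctᶠ (A ++ o ∷ B)
blocked-suffix-¬Correctᶠ st nl nz A = blocked-suffix-¬Correctᶠ′ st nl nz _ A ≤-refl

blocked-prefix-¬Correctᶠ′ : ∀ {A o} → Stuckᶠ (A ++ [ o ]) → (∀ μ c → ¬ Tr o r μ c) → ¬ o ≡ 𝟎 →
         ∀ n B → sizes B < n → ¬ Correctᶠ (A ++ o ∷ B)
blocked-prefix-¬Correctᶠ′ {A} {o} st nr nz (suc n) B lt c with progress (A ++ o ∷ B)
... | inj₂ st' = nz (All𝟎-middle A (c _ done st'))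
... | inj₁ (zs , s) with stepAt A o B s
...   | inLeft s' eq = st _ (suffix-step s' [ o ])
...   | syncLeft {A₀ = A₀} {a} eqA t1 t2 eq = st _ (trans (cong (_++ [ o ]) eqA) (++-assoc A₀ [ a ] [ o ]) ≡▸ prefix-step A₀ (sync t1 t2))
...   | silentMid τ eq = st _ (prefix-step A (silent τ))
...   | syncRight eqB t1 t2 eq = nr _ _ t1
...   | inRight s' refl = blocked-prefix-¬Correctᶠ′ st nr nz n _ (<-≤-trans (step-shrinks s') (s≤s⁻¹ lt)) (Correctᶠ-step c s)

blocked-prefix-¬Correctᶠ : ∀ {A o} → Stuckᶠ (A ++ [ o ]) → (∀ μ c → ¬ Tr o r μ c) → ¬ o ≡ 𝟎 → ∀ B → ¬ Correctᶠ (A ++ o ∷ B)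
blocked-prefix-¬Correctᶠ st nr nz B = blocked-prefix-¬Correctᶠ′ st nr nz _ B ≤-refl

infix 4 _≈ᶠ_
_≈ᶠ_ : List Proc → List Proc → Set
ks ≈ᶠ ks' = ∀ A B → Correctᶠ (A ++ ks ++ B) ⇔ Correctᶠ (A ++ ks' ++ B)

≈ᶠ-sym : ∀ {ks ks'} → ks ≈ᶠ ks' → ks' ≈ᶠ ks
≈ᶠ-sym e A B = ⇔.sym (e A B)

infixr 4 _⨾_
_⨾_ : ∀ {ks ks' ks''} → ks ≈ᶠ ks' → ks' ≈ᶠ ks'' → ks ≈ᶠ ks''
(e ⨾ f) A B = ⇔.trans (e A B) (f A B)

≈ᶠ-step : ∀ {ks ks'} → ks ⟶ᶠ ks' → ks ≈ᶠ ks'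
≈ᶠ-step s A B = step-Correctᶠ (prefix-step A (suffix-step s B))

≈ᶠ-step≡ : ∀ {xs ys ys'} → xs ⟶ᶠ ys → ys ≡ ys' → xs ≈ᶠ ys'
≈ᶠ-step≡ s refl = ≈ᶠ-step s

≡⇒⇔ : ∀ {xs ys} → xs ≡ ys → Correctᶠ xs ⇔ Correctᶠ ys
≡⇒⇔ refl = ⇔.refl

≈ᶠ-after : ∀ {ks ks'} → ks ≈ᶠ ks' → ∀ A₀ ca B → Correctᶠ (A₀ ++ ca ++ ks ++ B) ⇔ Correctᶠ (A₀ ++ ca ++ ks' ++ B)
≈ᶠ-after {ks} {ks'} e A₀ ca B =
  ⇔.trans (≡⇒⇔ (sym (++-assoc A₀ ca (ks ++ B)))) (⇔.trans (e (A₀ ++ ca) B) (≡⇒⇔ (++-assoc A₀ ca (ks' ++ B))))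

both-¬Correctᶠ : ∀ {xs ys} → ¬ Correctᶠ xs → ¬ Correctᶠ ys → Correctᶠ xs ⇔ Correctᶠ ys
both-¬Correctᶠ n m = mk⇔ (λ c → ⊥-elim (n c)) (λ c → ⊥-elim (m c))

stuck-¬Correctᶠ : ∀ A {k B} → ¬ k ≡ 𝟎 → Stuckᶠ (A ++ k ∷ B) → ¬ Correctᶠ (A ++ k ∷ B)
stuck-¬Correctᶠ A nz st c = nz (All𝟎-middle A (c _ done st))

Simulates : Proc → Proc → Set
Simulates k k' = (∀ {c μ ck} → Tr k c μ ck → Σ _ λ ck' → Tr k' c μ ck' × ck ≈ᶠ ck') ×
           (∀ {ck} → Tau k ck → Σ _ λ ck' → Tau k' ck' × ck ≈ᶠ ck')

module LeafCong (k k' : Proc) (nz : ¬ k ≡ 𝟎) (nz' : ¬ k' ≡ 𝟎) (S : Simulates k k') (S' : Simulates k' k) where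
  R : List Proc → List Proc → Set
  R xs ys = Σ _ λ A → Σ _ λ B → (xs ≡ A ++ k ∷ B) × (ys ≡ A ++ k' ∷ B)

  stuck-transfer : ∀ {k k'} → Simulates k' k → ∀ A B → Stuckᶠ (A ++ k ∷ B) → Stuckᶠ (A ++ k' ∷ B)
  stuck-transfer {k} {k'} S' A B st zs s with stepAt A k' B s
  ... | inLeft s' eq = st _ (step-inLeft k B s')
  ... | syncLeft eqA t1 t2 eq = st _ (step-syncLeft k B eqA t1 (proj₁ (proj₂ (proj₁ S' t2))))
  ... | silentMid τ eq = st _ (step-silentMid A B (proj₁ (proj₂ (proj₂ S' τ))))
  ... | syncRight eqB t1 t2 eq = st _ (step-syncRight A eqB (proj₁ (proj₂ (proj₁ S' t1))) t2)
  ... | inRight s' eq = st _ (step-inRight A k s')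

  move : ∀ {xs ys} → R xs ys → Move R xs ys
  move (A , B , refl , refl) with progress (A ++ k ∷ B)
  ... | inj₂ st = decided (both-¬Correctᶠ (stuck-¬Correctᶠ A nz st) (stuck-¬Correctᶠ A nz' (stuck-transfer S' A B st)))
  ... | inj₁ (zs , s) with stepAt A k B s
  ...   | inLeft s' refl = both (step-inLeft k B s') (step-inLeft k' B s') (_ , _ , refl , refl)
  ...   | inRight s' refl = both (step-inRight A k s') (step-inRight A k' s') (_ , _ , refl , refl)
  ...   | syncLeft {A₀ = A₀} {ca = ca} eqA t1 t2 refl with proj₁ S t2
  ...     | ck' , t2' , e = decided (⇔.trans (step-Correctᶠ s) (⇔.trans (≈ᶠ-after e A₀ ca B) (⇔.sym (step-Correctᶠ (step-syncLeft k' B eqA t1 t2')))))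
  move (A , B , refl , refl) | inj₁ (zs , s) | silentMid τ refl with proj₂ S τ
  ...     | ck' , τ' , e = decided (⇔.trans (step-Correctᶠ s) (⇔.trans (e A B) (⇔.sym (step-Correctᶠ (step-silentMid A B τ')))))
  move (A , B , refl , refl) | inj₁ (zs , s) | syncRight {B₀ = B₀} {cb = cb} eqB t1 t2 refl with proj₁ S t1
  ...     | ck' , t1' , e = decided (⇔.trans (step-Correctᶠ s) (⇔.trans (e A (cb ++ B₀)) (⇔.sym (step-Correctᶠ (step-syncRight A eqB t1' t2)))))

  result : [ k ] ≈ᶠ [ k' ]
  result A B = up-to R move (A , B , refl , refl)

leaf-cong : ∀ {k k'} → ¬ k ≡ 𝟎 → ¬ k' ≡ 𝟎 → Simulates k k' → Simulates k' k → [ k ] ≈ᶠ [ k' ]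
leaf-cong {k} {k'} nz nz' S S' = LeafCong.result k k' nz nz' S S'

NoR NoL NoTau : Proc → Set
NoR k = ∀ μ c → ¬ Tr k r μ c
NoL k = ∀ μ c → ¬ Tr k l μ c
NoTau k = ∀ c → ¬ Tau k c

-- As o never acts on l, X can only interact with what o leaves after acting on r;
-- by confluence the steps of X can be postponed until then, so X may as well sit
-- in the continuation of o.
module ExtrudeRight (X : List Proc) (o o' : Proc) (nLo : NoL o) (nTo : NoTau o) (nzo : ¬ o ≡ 𝟎)
  (nLo' : NoL o') (nTo' : NoTau o') (nzo' : ¬ o' ≡ 𝟎)
  (lift : ∀ {μ c} → Tr o r μ c → Tr o' r μ (X ++ c))
  (lower : ∀ {μ c'} → Tr o' r μ c' → Σ _ λ c → Tr o r μ c × (c' ≡ X ++ c)) where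

  R : List Proc → List Proc → Set
  R xs ys = Σ _ λ A₀ → Σ _ λ Y → Σ _ λ B → (ys ≡ A₀ ++ o' ∷ B) × (xs ≡ Y ++ o ∷ B) × ((A₀ ++ X) ⟶ᶠ* Y)

  move : ∀ {xs ys} → R xs ys → Move R xs ys
  move (A₀ , Y , B , refl , refl , run) with progress (Y ++ o ∷ B)
  ... | inj₂ st = decided (both-¬Correctᶠ (stuck-¬Correctᶠ Y nzo st) (blocked-suffix-¬Correctᶠ st' nLo' nzo' A₀))
    where st' : Stuckᶠ (o' ∷ B)
          st' zs (sync t1 t2) with lower t1
          ... | c , t1' , _ = st _ (step-syncRight Y refl t1' t2)
          st' zs (silent τ) = nTo' _ τ
          st' zs (there s) = st _ (step-inRight Y o s)
  ... | inj₁ (zs , s) with stepAt Y o B s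
  ...   | inLeft s' refl = left s (A₀ , _ , B , refl , refl , run ◅◅ (s' ∷s done))
  ...   | syncLeft eqA t1 t2 refl = ⊥-elim (nLo _ _ t2)
  ...   | silentMid τ refl = ⊥-elim (nTo _ τ)
  ...   | inRight s' refl = both s (step-inRight A₀ o' s') (A₀ , Y , _ , refl , refl , run)
  ...   | syncRight {B₀ = B₀} {ck = c} {cb = cb} refl t1 t2 refl =
          decided (⇔.trans (step-Correctᶠ s) (⇔.trans (⇔.sym (run-Correctᶠ (suffix-run run (c ++ cb ++ B₀))))
                (⇔.trans (≡⇒⇔ (++-assoc A₀ X (c ++ cb ++ B₀)))
                 (⇔.trans (≡⇒⇔ (cong (A₀ ++_) (sym (++-assoc X c (cb ++ B₀)))))
                  (⇔.sym (step-Correctᶠ (step-syncRight A₀ refl (lift t1) t2)))))))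

  result : (X ++ [ o ]) ≈ᶠ [ o' ]
  result A B = ⇔.trans (≡⇒⇔ eq) (up-to R move (A , A ++ X , B , refl , refl , done))
    where eq : A ++ (X ++ [ o ]) ++ B ≡ (A ++ X) ++ o ∷ B
          eq = trans (cong (A ++_) (++-assoc X [ o ] B)) (sym (++-assoc A X (o ∷ B)))

module ExtrudeLeft (X : List Proc) (o o' : Proc) (nRo : NoR o) (nTo : NoTau o) (nzo : ¬ o ≡ 𝟎)
  (nRo' : NoR o') (nTo' : NoTau o') (nzo' : ¬ o' ≡ 𝟎)
  (lift : ∀ {μ c} → Tr o l μ c → Tr o' l μ (c ++ X))
  (lower : ∀ {μ c'} → Tr o' l μ c' → Σ _ λ c → Tr o l μ c × (c' ≡ c ++ X)) where

  R : List Proc → List Proc → Set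
  R xs ys = Σ _ λ A → Σ _ λ Y → Σ _ λ B₀ → (ys ≡ A ++ o' ∷ B₀) × (xs ≡ A ++ o ∷ Y) × ((X ++ B₀) ⟶ᶠ* Y)

  move : ∀ {xs ys} → R xs ys → Move R xs ys
  move (A , Y , B₀ , refl , refl , run) with progress (A ++ o ∷ Y)
  ... | inj₂ st = decided (both-¬Correctᶠ (stuck-¬Correctᶠ A nzo st) (blocked-prefix-¬Correctᶠ st' nRo' nzo' B₀))
    where st' : Stuckᶠ (A ++ [ o' ])
          st' zs s with stepAt A o' [] s
          ... | inLeft s' eq = st _ (step-inLeft o Y s')
          ... | syncLeft eqA t1 t2 eq with lower t2
          ...   | c , t2' , _ = st _ (step-syncLeft o Y eqA t1 t2')
          st' zs s | silentMid τ eq = nTo' _ τ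
          st' zs s | syncRight () t1 t2 eq
          st' zs s | inRight () eq
  ... | inj₁ (zs , s) with stepAt A o Y s
  ...   | inLeft s' refl = both s (step-inLeft o' B₀ s') (_ , Y , B₀ , refl , refl , run)
  ...   | syncRight eqB t1 t2 refl = ⊥-elim (nRo _ _ t1)
  ...   | silentMid τ refl = ⊥-elim (nTo _ τ)
  ...   | inRight s' refl = left s (A , _ , B₀ , refl , refl , run ◅◅ (s' ∷s done))
  ...   | syncLeft {A₀ = A₀} {ca = ca} {ck = c} eqA t1 t2 refl =
          decided (⇔.trans (step-Correctᶠ s) (⇔.trans (≡⇒⇔ eq1) (⇔.trans (⇔.sym (run-Correctᶠ (prefix-run (A₀ ++ ca ++ c) run)))
                (⇔.trans (≡⇒⇔ eq2) (⇔.sym (step-Correctᶠ (step-syncLeft o' B₀ eqA t1 (lift t2))))))))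
    where eq1 : A₀ ++ ca ++ c ++ Y ≡ (A₀ ++ ca ++ c) ++ Y
          eq1 = trans (cong (A₀ ++_) (sym (++-assoc ca c Y))) (sym (++-assoc A₀ (ca ++ c) Y))
          eq2 : (A₀ ++ ca ++ c) ++ X ++ B₀ ≡ A₀ ++ ca ++ (c ++ X) ++ B₀
          eq2 = trans (++-assoc A₀ (ca ++ c) (X ++ B₀))
                 (cong (A₀ ++_) (trans (++-assoc ca c (X ++ B₀)) (cong (ca ++_) (sym (++-assoc c X B₀)))))

  result : (o ∷ X) ≈ᶠ [ o' ]
  result A B = up-to R move (A , X ++ B , B , refl , refl , done)

-- k performs an l-action and then an r-action, k' the same actions in the other
-- order; as the two actions involve different neighbours, the order is unobservable.
module Swap (k k' : Proc)
  (k-acts-on-l : ∀ {c μ ck} → Tr k c μ ck → (c ≡ l) × Σ Proc (λ k₁ → ck ≡ [ k₁ ]))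
  (k'-acts-on-r : ∀ {c μ ck} → Tr k' c μ ck → (c ≡ r) × Σ Proc (λ k₂ → ck ≡ [ k₂ ]))
  (nTk : NoTau k) (nTk' : NoTau k') (nzk : ¬ k ≡ 𝟎) (nzk' : ¬ k' ≡ 𝟎)
  (k-residual : ∀ {μ k₁} → Tr k l μ [ k₁ ] → (¬ k₁ ≡ 𝟎) × NoTau k₁ × NoL k₁)
  (k'-residual : ∀ {ν k₂} → Tr k' r ν [ k₂ ] → (¬ k₂ ≡ 𝟎) × NoTau k₂ × NoR k₂)
  (k-residual-on-r : ∀ {μ k₁ ν c} → Tr k l μ [ k₁ ] → Tr k₁ r ν c → Σ Proc λ k₂ → Tr k' r ν [ k₂ ])
  (k'-residual-on-l : ∀ {ν k₂ μ c} → Tr k' r ν [ k₂ ] → Tr k₂ l μ c → Σ Proc λ k₁ → Tr k l μ [ k₁ ])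
  (residuals-commute : ∀ {μ k₁ ν k₂} → Tr k l μ [ k₁ ] → Tr k' r ν [ k₂ ] → Σ _ λ c → Tr k₁ r ν c × Tr k₂ l μ c) where

  R : List Proc → List Proc → Set
  R xs ys = Σ _ λ A → Σ _ λ B → (xs ≡ A ++ k ∷ B) × (ys ≡ A ++ k' ∷ B)

  -- the only way A ++ [ k ] can move when A is stuck
  data LStep (A : List Proc) : Set where
    lstep : ∀ {A₀ a μ ca k₁} → A ≡ A₀ ++ [ a ] → Tr a r μ ca → Tr k l (dualLabel μ) [ k₁ ] → LStep A

  lstepOf : ∀ A {zs} → Stuckᶠ A → (A ++ [ k ]) ⟶ᶠ zs → LStep A
  lstepOf A stA s with stepAt A k [] s
  ... | inLeft s' eq = ⊥-elim (stA _ s')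
  ... | syncLeft eqA t1 t2 eq with k-acts-on-l t2
  ...   | refl , k₁ , refl = lstep eqA t1 t2
  lstepOf A stA s | silentMid τ eq = ⊥-elim (nTk _ τ)
  lstepOf A stA s | syncRight () t1 t2 eq
  lstepOf A stA s | inRight () eq

  data RStep (B : List Proc) : Set where
    rstep : ∀ {b B₀ ν cb k₂} → B ≡ b ∷ B₀ → Tr k' r ν [ k₂ ] → Tr b l (dualLabel ν) cb → RStep B

  rstepOf : ∀ B {zs} → Stuckᶠ B → (k' ∷ B) ⟶ᶠ zs → RStep B
  rstepOf B stB (sync t1 t2) with k'-acts-on-r t1
  ... | refl , k₂ , refl = rstep refl t1 t2
  rstepOf B stB (silent τ) = ⊥-elim (nTk' _ τ)
  rstepOf B stB (there s) = ⊥-elim (stB _ s)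

  lhsStuck : ∀ A B → Stuckᶠ A → Stuckᶠ B → Stuckᶠ (A ++ [ k ]) → Stuckᶠ (A ++ k ∷ B)
  lhsStuck A B stA stB stX zs s with stepAt A k B s
  ... | inLeft s' eq = stA _ s'
  ... | syncLeft eqA t1 t2 eq = stX _ (step-syncLeft k [] eqA t1 t2)
  ... | silentMid τ eq = nTk _ τ
  ... | syncRight eqB t1 t2 eq with k-acts-on-l t1
  ...   | () , _
  lhsStuck A B stA stB stX zs s | inRight s' eq = stB _ s'

  rhsStuck : ∀ A B → Stuckᶠ A → Stuckᶠ B → Stuckᶠ (k' ∷ B) → Stuckᶠ (A ++ k' ∷ B)
  rhsStuck A B stA stB stY zs s with stepAt A k' B s
  ... | inLeft s' eq = stA _ s'
  ... | syncLeft eqA t1 t2 eq with k'-acts-on-r t2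
  ...   | () , _
  rhsStuck A B stA stB stY zs s | silentMid τ eq = nTk' _ τ
  rhsStuck A B stA stB stY zs s | syncRight refl t1 t2 eq = stY _ (sync t1 t2)
  rhsStuck A B stA stB stY zs s | inRight s' eq = stB _ s'

  move : ∀ {xs ys} → R xs ys → Move R xs ys
  move (A , B , refl , refl) with progress A
  ... | inj₁ (A' , s) = both (step-inLeft k B s) (step-inLeft k' B s) (_ , _ , refl , refl)
  ... | inj₂ stA with progress B
  ...   | inj₁ (B' , s) = both (step-inRight A k s) (step-inRight A k' s) (_ , _ , refl , refl)
  ...   | inj₂ stB with progress (A ++ [ k ]) | progress (k' ∷ B)
  ...     | inj₂ stX | inj₂ stY =
            decided (both-¬Correctᶠ (stuck-¬Correctᶠ A nzk (lhsStuck A B stA stB stX)) (stuck-¬Correctᶠ A nzk' (rhsStuck A B stA stB stY)))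
  ...     | inj₁ (_ , sx) | inj₂ stY with lstepOf A stA sx
  ...       | lstep {A₀ = A₀} {ca = ca} {k₁ = k₁} eqA ta tk =
              decided (both-¬Correctᶠ (λ c → blocked-suffix-¬Correctᶠ residual-stuck (proj₂ (proj₂ (k-residual tk))) (proj₁ (k-residual tk)) (A₀ ++ ca)
                                        (Equivalence.to (≡⇒⇔ (sym (++-assoc A₀ ca (k₁ ∷ B)))) (Correctᶠ-step c (step-syncLeft k B eqA ta tk))))
                              (stuck-¬Correctᶠ A nzk' (rhsStuck A B stA stB stY)))
    where residual-stuck : Stuckᶠ (k₁ ∷ B)
          residual-stuck zs (sync t1 t2) with k-residual-on-r tk t1
          ... | k₂ , t' = stY _ (sync t' t2)
          residual-stuck zs (silent τ) = proj₁ (proj₂ (k-residual tk)) _ τ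
          residual-stuck zs (there s) = stB _ s
  move (A , B , refl , refl) | inj₂ stA | inj₂ stB | inj₂ stX | inj₁ (_ , sy) with rstepOf B stB sy
  ...       | rstep {B₀ = B₀} {cb = cb} {k₂ = k₂} eqB tk tb =
              decided (both-¬Correctᶠ (stuck-¬Correctᶠ A nzk (lhsStuck A B stA stB stX))
                              (λ c → blocked-prefix-¬Correctᶠ residual-stuck (proj₂ (proj₂ (k'-residual tk))) (proj₁ (k'-residual tk)) (cb ++ B₀)
                                        (Correctᶠ-step c (step-syncRight A eqB tk tb))))
    where residual-stuck : Stuckᶠ (A ++ [ k₂ ])
          residual-stuck zs s with stepAt A k₂ [] s
          ... | inLeft s' eq = stA _ s'
          ... | syncLeft eqA t1 t2 eq with k'-residual-on-l tk t2
          ...   | k₁ , t' = stX _ (step-syncLeft k [] eqA t1 t')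
          residual-stuck zs s | silentMid τ eq = proj₁ (proj₂ (k'-residual tk)) _ τ
          residual-stuck zs s | syncRight () t1 t2 eq
          residual-stuck zs s | inRight () eq
  move (A , B , refl , refl) | inj₂ stA | inj₂ stB | inj₁ (_ , sx) | inj₁ (_ , sy) with lstepOf A stA sx | rstepOf B stB sy
  ... | lstep {A₀ = A₀} {ca = ca} {k₁ = k₁} eqA ta tk | rstep {B₀ = B₀} {cb = cb} {k₂ = k₂} eqB tk' tb with residuals-commute tk tk'
  ...   | c , t1 , t2 =
          decided (⇔.trans (step-Correctᶠ (step-syncLeft k B eqA ta tk))
               (⇔.trans (≡⇒⇔ (sym (++-assoc A₀ ca (k₁ ∷ B))))
               (⇔.trans (step-Correctᶠ (step-syncRight (A₀ ++ ca) eqB t1 tb))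
               (⇔.trans (≡⇒⇔ (++-assoc A₀ ca (c ++ cb ++ B₀)))
               (⇔.sym (⇔.trans (step-Correctᶠ (step-syncRight A eqB tk' tb)) (step-Correctᶠ (step-syncLeft k₂ (cb ++ B₀) eqA ta t2))))))))

  result : [ k ] ≈ᶠ [ k' ]
  result A B = up-to R move (A , B , refl , refl)

module ZeroZero where
  R : List Proc → List Proc → Set
  R xs ys = Σ _ λ A → Σ _ λ B → (xs ≡ A ++ 𝟎 ∷ 𝟎 ∷ B) × (ys ≡ A ++ 𝟎 ∷ B)

  All𝟎-drop𝟎 : ∀ A {B} → All𝟎 (A ++ 𝟎 ∷ 𝟎 ∷ B) → All𝟎 (A ++ 𝟎 ∷ B)
  All𝟎-drop𝟎 [] (p ∷ _ ∷ ps) = p ∷ ps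
  All𝟎-drop𝟎 (a ∷ A) (p ∷ ps) = p ∷ All𝟎-drop𝟎 A ps

  All𝟎-dup𝟎 : ∀ A {B} → All𝟎 (A ++ 𝟎 ∷ B) → All𝟎 (A ++ 𝟎 ∷ 𝟎 ∷ B)
  All𝟎-dup𝟎 [] (p ∷ ps) = p ∷ p ∷ ps
  All𝟎-dup𝟎 (a ∷ A) (p ∷ ps) = p ∷ All𝟎-dup𝟎 A ps

  stuck⇒Correctᶠ⇔All𝟎 : ∀ {xs} → Stuckᶠ xs → Correctᶠ xs ⇔ All𝟎 xs
  stuck⇒Correctᶠ⇔All𝟎 st = mk⇔ (λ c → c _ done st) (λ { z ys done st' → z ; z ys (s ∷s _) st' → ⊥-elim (st _ s) })

  move : ∀ {xs ys} → R xs ys → Move R xs ys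
  move (A , B , refl , refl) with progress (A ++ 𝟎 ∷ 𝟎 ∷ B)
  ... | inj₁ (zs , s) with stepAt A 𝟎 (𝟎 ∷ B) s
  ...   | inLeft s' refl = both (step-inLeft 𝟎 (𝟎 ∷ B) s') (step-inLeft 𝟎 B s') (_ , _ , refl , refl)
  ...   | syncLeft eqA t1 () eq
  ...   | silentMid () eq
  ...   | syncRight eqB () t2 eq
  ...   | inRight (sync () _) eq
  ...   | inRight (silent ()) eq
  ...   | inRight (there s') refl = both (step-inRight A 𝟎 (there s')) (step-inRight A 𝟎 s') (_ , _ , refl , refl)
  move (A , B , refl , refl) | inj₂ st = decided (⇔.trans (stuck⇒Correctᶠ⇔All𝟎 st) (⇔.trans (mk⇔ (All𝟎-drop𝟎 A) (All𝟎-dup𝟎 A)) (⇔.sym (stuck⇒Correctᶠ⇔All𝟎 st'))))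
    where st' : Stuckᶠ (A ++ 𝟎 ∷ B)
          st' zs s with stepAt A 𝟎 B s
          ... | inLeft s' eq = st _ (step-inLeft 𝟎 (𝟎 ∷ B) s')
          ... | syncLeft eqA t1 () eq
          ... | silentMid () eq
          ... | syncRight eqB () t2 eq
          ... | inRight s' eq = st _ (step-inRight A 𝟎 (there s'))

𝟎𝟎≈ᶠ𝟎 : (𝟎 ∷ 𝟎 ∷ []) ≈ᶠ [ 𝟎 ]
𝟎𝟎≈ᶠ𝟎 A B = up-to ZeroZero.R ZeroZero.move (A , B , refl , refl)

nz-inp : ∀ {c x t P} → ¬ inp c x t P ≡ 𝟎
nz-inp ()
nz-out : ∀ {c e P} → ¬ out c e P ≡ 𝟎
nz-out ()
nz-sel : ∀ {c s P} → ¬ sel c s P ≡ 𝟎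
nz-sel ()
nz-bra : ∀ {c P Q} → ¬ bra c P Q ≡ 𝟎
nz-bra ()

inp-cong : ∀ {c x y t P Q} → (∀ v → v ∈ᵥ t → flat (substP P v x) ≈ᶠ flat (substP Q v y)) → [ inp c x t P ] ≈ᶠ [ inp c y t Q ]
inp-cong cont≈ = leaf-cong nz-inp nz-inp
  ((λ { (tr-in {v = v} m) → _ , tr-in m , cont≈ v m }) , (λ ()))
  ((λ { (tr-in {v = v} m) → _ , tr-in m , ≈ᶠ-sym (cont≈ v m) }) , (λ ()))

out-cong : ∀ {c e P Q} → flat P ≈ᶠ flat Q → [ out c e P ] ≈ᶠ [ out c e Q ]
out-cong cont≈ = leaf-cong nz-out nz-out ((λ { (tr-out d) → _ , tr-out d , cont≈ }) , (λ ())) ((λ { (tr-out d) → _ , tr-out d , ≈ᶠ-sym cont≈ }) , (λ ()))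

sel-cong : ∀ {c s P Q} → flat P ≈ᶠ flat Q → [ sel c s P ] ≈ᶠ [ sel c s Q ]
sel-cong cont≈ = leaf-cong nz-sel nz-sel ((λ { tr-sel → _ , tr-sel , cont≈ }) , (λ ())) ((λ { tr-sel → _ , tr-sel , ≈ᶠ-sym cont≈ }) , (λ ()))

bra-cong : ∀ {c P Q P' Q'} → flat P ≈ᶠ flat P' → flat Q ≈ᶠ flat Q' → [ bra c P Q ] ≈ᶠ [ bra c P' Q' ]
bra-cong {c} {P} {Q} {P'} {Q'} inl≈ inr≈ = leaf-cong nz-bra nz-bra (forth , (λ ())) (back , (λ ()))
  where forth : ∀ {c' μ ck} → Tr (bra c P Q) c' μ ck → Σ _ λ ck' → Tr (bra c P' Q') c' μ ck' × ck ≈ᶠ ck'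
        forth (tr-bra {s = inl}) = _ , tr-bra , inl≈
        forth (tr-bra {s = inr}) = _ , tr-bra , inr≈
        back : ∀ {c' μ ck} → Tr (bra c P' Q') c' μ ck → Σ _ λ ck' → Tr (bra c P Q) c' μ ck' × ck ≈ᶠ ck'
        back (tr-bra {s = inl}) = _ , tr-bra , ≈ᶠ-sym inl≈
        back (tr-bra {s = inr}) = _ , tr-bra , ≈ᶠ-sym inr≈

extrudeʳ-out : ∀ W e P → (flat W ++ [ out r e P ]) ≈ᶠ [ out r e (W ⋈ P) ]
extrudeʳ-out W e P = ExtrudeRight.result (flat W) (out r e P) (out r e (W ⋈ P))
  (λ μ c ()) (λ c ()) nz-out (λ μ c ()) (λ c ()) nz-out
  (λ { (tr-out d) → tr-out d }) (λ { (tr-out d) → _ , tr-out d , refl })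

extrudeʳ-sel : ∀ W s P → (flat W ++ [ sel r s P ]) ≈ᶠ [ sel r s (W ⋈ P) ]
extrudeʳ-sel W s P = ExtrudeRight.result (flat W) (sel r s P) (sel r s (W ⋈ P))
  (λ μ c ()) (λ c ()) nz-sel (λ μ c ()) (λ c ()) nz-sel
  (λ { tr-sel → tr-sel }) (λ { tr-sel → _ , tr-sel , refl })

extrudeʳ-inp : ∀ W x t P → (∀ v → substP W v x ≡ W) → (flat W ++ [ inp r x t P ]) ≈ᶠ [ inp r x t (W ⋈ P) ]
extrudeʳ-inp W x t P closed = ExtrudeRight.result (flat W) (inp r x t P) (inp r x t (W ⋈ P))
  (λ μ c ()) (λ c ()) nz-inp (λ μ c ()) (λ c ()) nz-inp
  (λ { (tr-in {v = v} m) → subst (λ z → Tr (inp r x t (W ⋈ P)) r (rcv v) (flat z ++ flat (substP P v x))) (closed v) (tr-in {r} {x} {t} {W ⋈ P} m) })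
  (λ { (tr-in {v = v} m) → _ , tr-in m , cong (λ z → flat z ++ flat (substP P v x)) (closed v) })

extrudeʳ-bra : ∀ W P Q → (flat W ++ [ bra r P Q ]) ≈ᶠ [ bra r (W ⋈ P) (W ⋈ Q) ]
extrudeʳ-bra W P Q = ExtrudeRight.result (flat W) (bra r P Q) (bra r (W ⋈ P) (W ⋈ Q))
  (λ μ c ()) (λ c ()) nz-bra (λ μ c ()) (λ c ()) nz-bra lift lower
  where lift : ∀ {μ c} → Tr (bra r P Q) r μ c → Tr (bra r (W ⋈ P) (W ⋈ Q)) r μ (flat W ++ c)
        lift (tr-bra {s = inl}) = tr-bra
        lift (tr-bra {s = inr}) = tr-bra
        lower : ∀ {μ c'} → Tr (bra r (W ⋈ P) (W ⋈ Q)) r μ c' → Σ _ λ c → Tr (bra r P Q) r μ c × (c' ≡ flat W ++ c)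
        lower (tr-bra {s = inl}) = _ , tr-bra , refl
        lower (tr-bra {s = inr}) = _ , tr-bra , refl

extrudeˡ-out : ∀ W e P → (out l e P ∷ flat W) ≈ᶠ [ out l e (P ⋈ W) ]
extrudeˡ-out W e P = ExtrudeLeft.result (flat W) (out l e P) (out l e (P ⋈ W))
  (λ μ c ()) (λ c ()) nz-out (λ μ c ()) (λ c ()) nz-out
  (λ { (tr-out d) → tr-out d }) (λ { (tr-out d) → _ , tr-out d , refl })

extrudeˡ-sel : ∀ W s P → (sel l s P ∷ flat W) ≈ᶠ [ sel l s (P ⋈ W) ]
extrudeˡ-sel W s P = ExtrudeLeft.result (flat W) (sel l s P) (sel l s (P ⋈ W))
  (λ μ c ()) (λ c ()) nz-sel (λ μ c ()) (λ c ()) nz-sel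
  (λ { tr-sel → tr-sel }) (λ { tr-sel → _ , tr-sel , refl })

extrudeˡ-inp : ∀ W x t P → (∀ v → substP W v x ≡ W) → (inp l x t P ∷ flat W) ≈ᶠ [ inp l x t (P ⋈ W) ]
extrudeˡ-inp W x t P closed = ExtrudeLeft.result (flat W) (inp l x t P) (inp l x t (P ⋈ W))
  (λ μ c ()) (λ c ()) nz-inp (λ μ c ()) (λ c ()) nz-inp
  (λ { (tr-in {v = v} m) → subst (λ z → Tr (inp l x t (P ⋈ W)) l (rcv v) (flat (substP P v x) ++ flat z)) (closed v) (tr-in {l} {x} {t} {P ⋈ W} m) })
  (λ { (tr-in {v = v} m) → _ , tr-in m , cong (λ z → flat (substP P v x) ++ flat z) (closed v) })

extrudeˡ-bra : ∀ W P Q → (bra l P Q ∷ flat W) ≈ᶠ [ bra l (P ⋈ W) (Q ⋈ W) ]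
extrudeˡ-bra W P Q = ExtrudeLeft.result (flat W) (bra l P Q) (bra l (P ⋈ W) (Q ⋈ W))
  (λ μ c ()) (λ c ()) nz-bra (λ μ c ()) (λ c ()) nz-bra lift lower
  where lift : ∀ {μ c} → Tr (bra l P Q) l μ c → Tr (bra l (P ⋈ W) (Q ⋈ W)) l μ (c ++ flat W)
        lift (tr-bra {s = inl}) = tr-bra
        lift (tr-bra {s = inr}) = tr-bra
        lower : ∀ {μ c'} → Tr (bra l (P ⋈ W) (Q ⋈ W)) l μ c' → Σ _ λ c → Tr (bra l P Q) l μ c × (c' ≡ c ++ flat W)
        lower (tr-bra {s = inl}) = _ , tr-bra , refl
        lower (tr-bra {s = inr}) = _ , tr-bra , refl

swap-inpˡ-outʳ : ∀ x t w P → [ inp l x t (out r (val w) P) ] ≈ᶠ [ out r (val w) (inp l x t P) ]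
swap-inpˡ-outʳ x t w P = Swap.result (inp l x t (out r (val w) P)) (out r (val w) (inp l x t P))
  (λ { (tr-in m) → refl , _ , refl }) (λ { (tr-out d) → refl , _ , refl })
  (λ c ()) (λ c ()) nz-inp nz-out
  (λ { (tr-in m) → nz-out , (λ c ()) , (λ μ c ()) }) (λ { (tr-out d) → nz-inp , (λ c ()) , (λ μ c ()) })
  (λ { (tr-in m) (tr-out d) → _ , tr-out d }) (λ { (tr-out d) (tr-in m) → _ , tr-in m })
  (λ { (tr-in m) (tr-out d) → _ , tr-out d , tr-in m })

swap-inpˡ-selʳ : ∀ x t s P → [ inp l x t (sel r s P) ] ≈ᶠ [ sel r s (inp l x t P) ]
swap-inpˡ-selʳ x t s P = Swap.result (inp l x t (sel r s P)) (sel r s (inp l x t P))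
  (λ { (tr-in m) → refl , _ , refl }) (λ { tr-sel → refl , _ , refl })
  (λ c ()) (λ c ()) nz-inp nz-sel
  (λ { (tr-in m) → nz-sel , (λ c ()) , (λ μ c ()) }) (λ { tr-sel → nz-inp , (λ c ()) , (λ μ c ()) })
  (λ { (tr-in m) tr-sel → _ , tr-sel }) (λ { tr-sel (tr-in m) → _ , tr-in m })
  (λ { (tr-in m) tr-sel → _ , tr-sel , tr-in m })

-- The primed helpers take ck ≡ [ k₁ ] separately: Agda cannot unify [ k₁ ] with
-- flat (pick s P Q) before s is split.
swap-braˡ-outʳ : ∀ w P Q → [ bra l (out r (val w) P) (out r (val w) Q) ] ≈ᶠ [ out r (val w) (bra l P Q) ]
swap-braˡ-outʳ w P Q = Swap.result (bra l (out r (val w) P) (out r (val w) Q)) (out r (val w) (bra l P Q))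
  acts-on-l (λ { (tr-out d) → refl , _ , refl })
  (λ c ()) (λ c ()) nz-bra nz-out
  residual (λ { (tr-out d) → nz-bra , (λ c ()) , (λ μ c ()) })
  residual-on-r residual-on-l residuals-commute
  where acts-on-l : ∀ {c μ ck} → Tr (bra l (out r (val w) P) (out r (val w) Q)) c μ ck → (c ≡ l) × Σ Proc (λ k₁ → ck ≡ [ k₁ ])
        acts-on-l (tr-bra {s = inl}) = refl , _ , refl
        acts-on-l (tr-bra {s = inr}) = refl , _ , refl
        residual′ : ∀ {μ ck k₁} → Tr (bra l (out r (val w) P) (out r (val w) Q)) l μ ck → ck ≡ [ k₁ ] → (¬ k₁ ≡ 𝟎) × NoTau k₁ × NoL k₁
        residual′ (tr-bra {s = inl}) refl = nz-out , (λ c ()) , (λ μ c ())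
        residual′ (tr-bra {s = inr}) refl = nz-out , (λ c ()) , (λ μ c ())
        residual : ∀ {μ k₁} → Tr (bra l (out r (val w) P) (out r (val w) Q)) l μ [ k₁ ] → (¬ k₁ ≡ 𝟎) × NoTau k₁ × NoL k₁
        residual t = residual′ t refl
        residual-on-r′ : ∀ {μ ck k₁ ν c} → Tr (bra l (out r (val w) P) (out r (val w) Q)) l μ ck → ck ≡ [ k₁ ] → Tr k₁ r ν c → Σ Proc λ k₂ → Tr (out r (val w) (bra l P Q)) r ν [ k₂ ]
        residual-on-r′ (tr-bra {s = inl}) refl (tr-out d) = _ , tr-out d
        residual-on-r′ (tr-bra {s = inr}) refl (tr-out d) = _ , tr-out d
        residual-on-r : ∀ {μ k₁ ν c} → Tr (bra l (out r (val w) P) (out r (val w) Q)) l μ [ k₁ ] → Tr k₁ r ν c → Σ Proc λ k₂ → Tr (out r (val w) (bra l P Q)) r ν [ k₂ ]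
        residual-on-r t t' = residual-on-r′ t refl t'
        residual-on-l : ∀ {ν k₂ μ c} → Tr (out r (val w) (bra l P Q)) r ν [ k₂ ] → Tr k₂ l μ c → Σ Proc λ k₁ → Tr (bra l (out r (val w) P) (out r (val w) Q)) l μ [ k₁ ]
        residual-on-l (tr-out d) (tr-bra {s = inl}) = _ , tr-bra {s = inl}
        residual-on-l (tr-out d) (tr-bra {s = inr}) = _ , tr-bra {s = inr}
        residuals-commute′ : ∀ {μ ck k₁ ν k₂} → Tr (bra l (out r (val w) P) (out r (val w) Q)) l μ ck → ck ≡ [ k₁ ] → Tr (out r (val w) (bra l P Q)) r ν [ k₂ ] →
             Σ _ λ c → Tr k₁ r ν c × Tr k₂ l μ c
        residuals-commute′ (tr-bra {s = inl}) refl (tr-out d) = _ , tr-out d , tr-bra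
        residuals-commute′ (tr-bra {s = inr}) refl (tr-out d) = _ , tr-out d , tr-bra
        residuals-commute : ∀ {μ k₁ ν k₂} → Tr (bra l (out r (val w) P) (out r (val w) Q)) l μ [ k₁ ] → Tr (out r (val w) (bra l P Q)) r ν [ k₂ ] →
             Σ _ λ c → Tr k₁ r ν c × Tr k₂ l μ c
        residuals-commute t t' = residuals-commute′ t refl t'

swap-braˡ-selʳ : ∀ s P Q → [ bra l (sel r s P) (sel r s Q) ] ≈ᶠ [ sel r s (bra l P Q) ]
swap-braˡ-selʳ s P Q = Swap.result (bra l (sel r s P) (sel r s Q)) (sel r s (bra l P Q))
  acts-on-l (λ { tr-sel → refl , _ , refl })
  (λ c ()) (λ c ()) nz-bra nz-sel
  residual (λ { tr-sel → nz-bra , (λ c ()) , (λ μ c ()) })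
  residual-on-r residual-on-l residuals-commute
  where acts-on-l : ∀ {c μ ck} → Tr (bra l (sel r s P) (sel r s Q)) c μ ck → (c ≡ l) × Σ Proc (λ k₁ → ck ≡ [ k₁ ])
        acts-on-l (tr-bra {s = inl}) = refl , _ , refl
        acts-on-l (tr-bra {s = inr}) = refl , _ , refl
        residual′ : ∀ {μ ck k₁} → Tr (bra l (sel r s P) (sel r s Q)) l μ ck → ck ≡ [ k₁ ] → (¬ k₁ ≡ 𝟎) × NoTau k₁ × NoL k₁
        residual′ (tr-bra {s = inl}) refl = nz-sel , (λ c ()) , (λ μ c ())
        residual′ (tr-bra {s = inr}) refl = nz-sel , (λ c ()) , (λ μ c ())
        residual : ∀ {μ k₁} → Tr (bra l (sel r s P) (sel r s Q)) l μ [ k₁ ] → (¬ k₁ ≡ 𝟎) × NoTau k₁ × NoL k₁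
        residual t = residual′ t refl
        residual-on-r′ : ∀ {μ ck k₁ ν c} → Tr (bra l (sel r s P) (sel r s Q)) l μ ck → ck ≡ [ k₁ ] → Tr k₁ r ν c → Σ Proc λ k₂ → Tr (sel r s (bra l P Q)) r ν [ k₂ ]
        residual-on-r′ (tr-bra {s = inl}) refl tr-sel = _ , tr-sel
        residual-on-r′ (tr-bra {s = inr}) refl tr-sel = _ , tr-sel
        residual-on-r : ∀ {μ k₁ ν c} → Tr (bra l (sel r s P) (sel r s Q)) l μ [ k₁ ] → Tr k₁ r ν c → Σ Proc λ k₂ → Tr (sel r s (bra l P Q)) r ν [ k₂ ]
        residual-on-r t t' = residual-on-r′ t refl t'
        residual-on-l : ∀ {ν k₂ μ c} → Tr (sel r s (bra l P Q)) r ν [ k₂ ] → Tr k₂ l μ c → Σ Proc λ k₁ → Tr (bra l (sel r s P) (sel r s Q)) l μ [ k₁ ]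
        residual-on-l tr-sel (tr-bra {s = inl}) = _ , tr-bra {s = inl}
        residual-on-l tr-sel (tr-bra {s = inr}) = _ , tr-bra {s = inr}
        residuals-commute′ : ∀ {μ ck k₁ ν k₂} → Tr (bra l (sel r s P) (sel r s Q)) l μ ck → ck ≡ [ k₁ ] → Tr (sel r s (bra l P Q)) r ν [ k₂ ] →
             Σ _ λ c → Tr k₁ r ν c × Tr k₂ l μ c
        residuals-commute′ (tr-bra {s = inl}) refl tr-sel = _ , tr-sel , tr-bra
        residuals-commute′ (tr-bra {s = inr}) refl tr-sel = _ , tr-sel , tr-bra
        residuals-commute : ∀ {μ k₁ ν k₂} → Tr (bra l (sel r s P) (sel r s Q)) l μ [ k₁ ] → Tr (sel r s (bra l P Q)) r ν [ k₂ ] →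
             Σ _ λ c → Tr k₁ r ν c × Tr k₂ l μ c
        residuals-commute t t' = residuals-commute′ t refl t'

-- Canonical forms and structural congruence

isZero : (a : Proc) → Dec (a ≡ 𝟎)
isZero 𝟎 = yes refl
isZero (inp c x t P) = no λ ()
isZero (out c e P) = no λ ()
isZero (sel c s P) = no λ ()
isZero (bra c P Q) = no λ ()
isZero (ifte e P Q) = no λ ()
isZero (P ⋈ Q) = no λ ()

-- Since 𝟎 ⋈ 𝟎 ≡ₛ 𝟎, canonical forms keep one 𝟎 of each run of 𝟎 components.
cons : Proc → List Proc → List Proc
cons 𝟎 (𝟎 ∷ bs) = 𝟎 ∷ bs
cons a bs = a ∷ bs

norm : List Proc → List Proc
norm [] = []
norm (a ∷ as) = cons a (norm as)

cons-nonzero : ∀ a bs → ¬ a ≡ 𝟎 → cons a bs ≡ a ∷ bs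
cons-nonzero 𝟎 bs nz = ⊥-elim (nz refl)
cons-nonzero (inp c x t P) bs nz = refl
cons-nonzero (out c e P) bs nz = refl
cons-nonzero (sel c s P) bs nz = refl
cons-nonzero (bra c P Q) bs nz = refl
cons-nonzero (ifte e P Q) bs nz = refl
cons-nonzero (P ⋈ Q) bs nz = refl

cons𝟎-nonzero : ∀ b bs → ¬ b ≡ 𝟎 → cons 𝟎 (b ∷ bs) ≡ 𝟎 ∷ b ∷ bs
cons𝟎-nonzero 𝟎 bs nz = ⊥-elim (nz refl)
cons𝟎-nonzero (inp c x t P) bs nz = refl
cons𝟎-nonzero (out c e P) bs nz = refl
cons𝟎-nonzero (sel c s P) bs nz = refl
cons𝟎-nonzero (bra c P Q) bs nz = refl
cons𝟎-nonzero (ifte e P Q) bs nz = refl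
cons𝟎-nonzero (P ⋈ Q) bs nz = refl

cons-idem : ∀ X → cons 𝟎 (cons 𝟎 X) ≡ cons 𝟎 X
cons-idem [] = refl
cons-idem (b ∷ X) with isZero b
... | yes refl = refl
... | no nz rewrite cons𝟎-nonzero b X nz = refl

consHead : ∀ a L → Σ _ λ L' → cons a L ≡ a ∷ L'
consHead a L with isZero a
... | no nz = L , cons-nonzero a L nz
consHead .𝟎 [] | yes refl = [] , refl
consHead .𝟎 (b ∷ L) | yes refl with isZero b
... | yes refl = L , refl
... | no nz = b ∷ L , cons𝟎-nonzero b L nz

norm-cons : ∀ a bs → norm (cons a bs) ≡ cons a (norm bs)
norm-cons a bs with isZero a
... | no nz rewrite cons-nonzero a bs nz = refl
norm-cons .𝟎 [] | yes refl = refl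
norm-cons .𝟎 (b ∷ bs) | yes refl with isZero b
... | yes refl = sym (cons-idem (norm bs))
... | no nz rewrite cons𝟎-nonzero b bs nz = refl

norm-idem : ∀ xs → norm (norm xs) ≡ norm xs
norm-idem [] = refl
norm-idem (a ∷ xs) = trans (norm-cons a (norm xs)) (cong (cons a) (norm-idem xs))

norm-++ʳ : ∀ xs ys → norm (xs ++ ys) ≡ norm (xs ++ norm ys)
norm-++ʳ [] ys = sym (norm-idem ys)
norm-++ʳ (a ∷ xs) ys = cong (cons a) (norm-++ʳ xs ys)

norm-cons-++ : ∀ a zs ys → norm (cons a zs ++ ys) ≡ cons a (norm (zs ++ ys))
norm-cons-++ a zs ys with isZero a
... | no nz rewrite cons-nonzero a zs nz = refl
norm-cons-++ .𝟎 [] ys | yes refl = refl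
norm-cons-++ .𝟎 (z ∷ zs) ys | yes refl with isZero z
... | yes refl = sym (cons-idem (norm (zs ++ ys)))
... | no nz rewrite cons𝟎-nonzero z zs nz = refl

norm-++ˡ : ∀ xs ys → norm (norm xs ++ ys) ≡ norm (xs ++ ys)
norm-++ˡ [] ys = refl
norm-++ˡ (a ∷ xs) ys = trans (norm-cons-++ a (norm xs) ys) (cong (cons a) (norm-++ˡ xs ys))

norm-++ : ∀ xs ys → norm (xs ++ ys) ≡ norm (norm xs ++ norm ys)
norm-++ xs ys = trans (sym (norm-++ˡ xs ys)) (norm-++ʳ (norm xs) ys)

cons-All : ∀ {P : Proc → Set} {a bs} → P a → All P bs → All P (cons a bs)
cons-All {a = a} {bs} pa pbs with isZero a
... | no nz rewrite cons-nonzero a bs nz = pa ∷ pbs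
cons-All {a = .𝟎} {[]} pa pbs | yes refl = pa ∷ pbs
cons-All {a = .𝟎} {b ∷ bs} pa (pb ∷ pbs) | yes refl with isZero b
... | yes refl = pb ∷ pbs
... | no nz rewrite cons𝟎-nonzero b bs nz = pa ∷ pb ∷ pbs

norm-All : ∀ {P : Proc → Set} {xs} → All P xs → All P (norm xs)
norm-All [] = []
norm-All (p ∷ ps) = cons-All p (norm-All ps)

PreservesZero : (Proc → Proc) → Proc → Set
PreservesZero f a = ((a ≡ 𝟎) → f a ≡ 𝟎) × (f a ≡ 𝟎 → a ≡ 𝟎)

map-cons : ∀ (f : Proc → Proc) {a bs} → PreservesZero f a → All (PreservesZero f) bs → map f (cons a bs) ≡ cons (f a) (map f bs)
map-cons f {a} {bs} za zbs with isZero a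
... | no nz rewrite cons-nonzero a bs nz | cons-nonzero (f a) (map f bs) (λ e → nz (proj₂ za e)) = refl
map-cons f {.𝟎} {[]} za zbs | yes refl rewrite proj₁ za refl = refl
map-cons f {.𝟎} {b ∷ bs} za (zb ∷ zbs) | yes refl with isZero b
... | yes refl rewrite proj₁ za refl = refl
... | no nz rewrite cons𝟎-nonzero b bs nz | proj₁ za refl = sym (cons𝟎-nonzero (f b) (map f bs) (λ e → nz (proj₂ zb e)))

map-norm : ∀ (f : Proc → Proc) {xs} → All (PreservesZero f) xs → map f (norm xs) ≡ norm (map f xs)
map-norm f [] = refl
map-norm f {a ∷ xs} (za ∷ zs) = trans (map-cons f za (norm-All zs)) (cong (cons (f a)) (map-norm f zs))

All𝟎-cons : ∀ a bs → All𝟎 (cons a bs) → (a ≡ 𝟎) × All𝟎 bs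
All𝟎-cons a bs p with isZero a
... | no nz rewrite cons-nonzero a bs nz = head p , tail p
All𝟎-cons .𝟎 [] p | yes refl = refl , []
All𝟎-cons .𝟎 (b ∷ bs) p | yes refl with isZero b
... | yes refl = refl , p
... | no nz rewrite cons𝟎-nonzero b bs nz = refl , tail p

All𝟎-norm : ∀ xs → All𝟎 (norm xs) → All𝟎 xs
All𝟎-norm [] p = []
All𝟎-norm (a ∷ xs) p = let (q , qs) = All𝟎-cons a (norm xs) p in q ∷ All𝟎-norm xs qs

data IsLeaf : Proc → Set where
  lf0 : IsLeaf 𝟎
  lfi : ∀ {c x t P} → IsLeaf (inp c x t P)
  lfo : ∀ {c e P} → IsLeaf (out c e P)
  lfs : ∀ {c s P} → IsLeaf (sel c s P)
  lfb : ∀ {c P Q} → IsLeaf (bra c P Q)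
  lff : ∀ {e P Q} → IsLeaf (ifte e P Q)

flat-leaf : ∀ {a} → IsLeaf a → flat a ≡ [ a ]
flat-leaf lf0 = refl
flat-leaf lfi = refl
flat-leaf lfo = refl
flat-leaf lfs = refl
flat-leaf lfb = refl
flat-leaf lff = refl

leaves-flat : ∀ P → All IsLeaf (flat P)
leaves-flat 𝟎 = lf0 ∷ []
leaves-flat (inp c x t P) = lfi ∷ []
leaves-flat (out c e P) = lfo ∷ []
leaves-flat (sel c s P) = lfs ∷ []
leaves-flat (bra c P Q) = lfb ∷ []
leaves-flat (ifte e P Q) = lff ∷ []
leaves-flat (P ⋈ Q) = ++⁺ (leaves-flat P) (leaves-flat Q)

NonEmpty : List Proc → Set
NonEmpty [] = ⊥
NonEmpty (_ ∷ _) = ⊤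

NonEmpty-++ : ∀ xs ys → NonEmpty xs → NonEmpty (xs ++ ys)
NonEmpty-++ (x ∷ xs) ys _ = tt

NonEmpty-flat : ∀ P → NonEmpty (flat P)
NonEmpty-flat 𝟎 = tt
NonEmpty-flat (inp c x t P) = tt
NonEmpty-flat (out c e P) = tt
NonEmpty-flat (sel c s P) = tt
NonEmpty-flat (bra c P Q) = tt
NonEmpty-flat (ifte e P Q) = tt
NonEmpty-flat (P ⋈ Q) = NonEmpty-++ (flat P) (flat Q) (NonEmpty-flat P)

NonEmpty-norm : ∀ xs → NonEmpty xs → NonEmpty (norm xs)
NonEmpty-norm (a ∷ xs) _ rewrite proj₂ (consHead a (norm xs)) = tt

build : List Proc → Proc
build [] = 𝟎
build (a ∷ []) = a
build (a ∷ b ∷ as) = a ⋈ build (b ∷ as)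

flat-build : ∀ ns → NonEmpty ns → All IsLeaf ns → flat (build ns) ≡ ns
flat-build (a ∷ []) _ (la ∷ []) = flat-leaf la
flat-build (a ∷ b ∷ ns) _ (la ∷ lns) = cong₂ _++_ (flat-leaf la) (flat-build (b ∷ ns) tt lns)

cf : Proc → Proc
cf 𝟎 = 𝟎
cf (inp c x t P) = inp c x t (cf P)
cf (out c e P) = out c e (cf P)
cf (sel c s P) = sel c s (cf P)
cf (bra c P Q) = bra c (cf P) (cf Q)
cf (ifte e P Q) = ifte e (cf P) (cf Q)
cf (P ⋈ Q) = build (norm (flat (cf P) ++ flat (cf Q)))

ncf : List Proc → List Proc
ncf xs = norm (map cf xs)

cf-leaf : ∀ {a} → IsLeaf a → IsLeaf (cf a)
cf-leaf lf0 = lf0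
cf-leaf lfi = lfi
cf-leaf lfo = lfo
cf-leaf lfs = lfs
cf-leaf lfb = lfb
cf-leaf lff = lff

cf-preservesZero : ∀ {a} → IsLeaf a → PreservesZero cf a
cf-preservesZero lf0 = (λ _ → refl) , (λ _ → refl)
cf-preservesZero lfi = (λ ()) , (λ ())
cf-preservesZero lfo = (λ ()) , (λ ())
cf-preservesZero lfs = (λ ()) , (λ ())
cf-preservesZero lfb = (λ ()) , (λ ())
cf-preservesZero lff = (λ ()) , (λ ())

All-map-leaf : ∀ {xs} → All IsLeaf xs → All IsLeaf (map cf xs)
All-map-leaf [] = []
All-map-leaf (lf ∷ ls) = cf-leaf lf ∷ All-map-leaf ls

All-cf-preservesZero : ∀ {xs} → All IsLeaf xs → All (PreservesZero cf) xs
All-cf-preservesZero [] = []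
All-cf-preservesZero (lf ∷ ls) = cf-preservesZero lf ∷ All-cf-preservesZero ls

flat-cf : ∀ P → flat (cf P) ≡ ncf (flat P)
flat-cf 𝟎 = refl
flat-cf (inp c x t P) = refl
flat-cf (out c e P) = refl
flat-cf (sel c s P) = refl
flat-cf (bra c P Q) = refl
flat-cf (ifte e P Q) = refl
flat-cf (P ⋈ Q) = begin
  flat (build (norm (flat (cf P) ++ flat (cf Q))))
    ≡⟨ flat-build _ (NonEmpty-norm _ (NonEmpty-++ (flat (cf P)) _ (NonEmpty-flat (cf P))))
                    (norm-All (++⁺ (leaves-flat (cf P)) (leaves-flat (cf Q)))) ⟩
  norm (flat (cf P) ++ flat (cf Q))
    ≡⟨ cong₂ (λ u v → norm (u ++ v)) (flat-cf P) (flat-cf Q) ⟩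
  norm (ncf (flat P) ++ ncf (flat Q))
    ≡⟨ sym (norm-++ (map cf (flat P)) (map cf (flat Q))) ⟩
  norm (map cf (flat P) ++ map cf (flat Q))
    ≡⟨ cong norm (sym (map-++ cf (flat P) (flat Q))) ⟩
  ncf (flat P ++ flat Q) ∎
  where open ≡-Reasoning

build-flat-cf : ∀ R → build (flat (cf R)) ≡ cf R
build-flat-cf 𝟎 = refl
build-flat-cf (inp c x t P) = refl
build-flat-cf (out c e P) = refl
build-flat-cf (sel c s P) = refl
build-flat-cf (bra c P Q) = refl
build-flat-cf (ifte e P Q) = refl
build-flat-cf (P ⋈ Q) = cong build (flat-build _ (NonEmpty-norm _ (NonEmpty-++ (flat (cf P)) _ (NonEmpty-flat (cf P))))
                                      (norm-All (++⁺ (leaves-flat (cf P)) (leaves-flat (cf Q)))))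

ncf-idem : ∀ xs → All IsLeaf xs → All (λ a → cf (cf a) ≡ cf a) xs → ncf (ncf xs) ≡ ncf xs
ncf-idem xs ls fs =
  trans (cong norm (map-norm cf (All-cf-preservesZero (All-map-leaf ls))))
  (trans (norm-idem (map cf (map cf xs))) (cong norm (trans (sym (map-∘ {g = cf} {f = cf} xs)) (eq xs fs))))
  where eq : ∀ xs → All (λ a → cf (cf a) ≡ cf a) xs → map (λ a → cf (cf a)) xs ≡ map cf xs
        eq [] [] = refl
        eq (x ∷ xs) (p ∷ ps) = cong₂ _∷_ p (eq xs ps)

mutual
  cf-idem : ∀ P → cf (cf P) ≡ cf P
  cf-idem 𝟎 = refl
  cf-idem (inp c x t P) = cong (inp c x t) (cf-idem P)
  cf-idem (out c e P) = cong (out c e) (cf-idem P)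
  cf-idem (sel c s P) = cong (sel c s) (cf-idem P)
  cf-idem (bra c P Q) = cong₂ (bra c) (cf-idem P) (cf-idem Q)
  cf-idem (ifte e P Q) = cong₂ (ifte e) (cf-idem P) (cf-idem Q)
  cf-idem (P ⋈ Q) = begin
    cf (cf (P ⋈ Q))                  ≡⟨ sym (build-flat-cf (cf (P ⋈ Q))) ⟩
    build (flat (cf (cf (P ⋈ Q))))   ≡⟨ cong build (flat-cf (cf (P ⋈ Q))) ⟩
    build (ncf (flat (cf (P ⋈ Q))))  ≡⟨ cong (λ xs → build (ncf xs)) (flat-cf (P ⋈ Q)) ⟩
    build (ncf (ncf (flat (P ⋈ Q)))) ≡⟨ cong build (ncf-idem (flat (P ⋈ Q)) (leaves-flat (P ⋈ Q)) (++⁺ (All-cf-idem P) (All-cf-idem Q))) ⟩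
    build (ncf (flat (P ⋈ Q)))       ≡⟨ cong build (sym (flat-cf (P ⋈ Q))) ⟩
    build (flat (cf (P ⋈ Q)))        ≡⟨ build-flat-cf (P ⋈ Q) ⟩
    cf (P ⋈ Q)                       ∎
    where open ≡-Reasoning

  All-cf-idem : ∀ P → All (λ a → cf (cf a) ≡ cf a) (flat P)
  All-cf-idem 𝟎 = refl ∷ []
  All-cf-idem (inp c x t P) = cong (inp c x t) (cf-idem P) ∷ []
  All-cf-idem (out c e P) = cong (out c e) (cf-idem P) ∷ []
  All-cf-idem (sel c s P) = cong (sel c s) (cf-idem P) ∷ []
  All-cf-idem (bra c P Q) = cong₂ (bra c) (cf-idem P) (cf-idem Q) ∷ []
  All-cf-idem (ifte e P Q) = cong₂ (ifte e) (cf-idem P) (cf-idem Q) ∷ []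
  All-cf-idem (P ⋈ Q) = ++⁺ (All-cf-idem P) (All-cf-idem Q)

module _ (v : Value) (x : Var) where
  sub : Proc → Proc
  sub a = substP a v x

  flat-subst : ∀ P → flat (substP P v x) ≡ map sub (flat P)
  flat-subst 𝟎 = refl
  flat-subst (inp c y t P) = refl
  flat-subst (out c e P) = refl
  flat-subst (sel c s P) = refl
  flat-subst (bra c P Q) = refl
  flat-subst (ifte e P Q) = refl
  flat-subst (P ⋈ Q) = trans (cong₂ _++_ (flat-subst P) (flat-subst Q)) (sym (map-++ sub (flat P) (flat Q)))

  build-subst : ∀ ns → substP (build ns) v x ≡ build (map sub ns)
  build-subst [] = refl
  build-subst (a ∷ []) = refl
  build-subst (a ∷ b ∷ ns) = cong (substP a v x ⋈_) (build-subst (b ∷ ns))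

  subst-preservesZero : ∀ a → PreservesZero sub a
  subst-preservesZero 𝟎 = (λ _ → refl) , (λ _ → refl)
  subst-preservesZero (inp c y t P) = (λ ()) , (λ ())
  subst-preservesZero (out c e P) = (λ ()) , (λ ())
  subst-preservesZero (sel c s P) = (λ ()) , (λ ())
  subst-preservesZero (bra c P Q) = (λ ()) , (λ ())
  subst-preservesZero (ifte e P Q) = (λ ()) , (λ ())
  subst-preservesZero (P ⋈ Q) = (λ ()) , (λ ())

  All-subst-preservesZero : ∀ xs → All (PreservesZero sub) xs
  All-subst-preservesZero [] = []
  All-subst-preservesZero (a ∷ xs) = subst-preservesZero a ∷ All-subst-preservesZero xs

  cf-subst : ∀ P → cf (substP P v x) ≡ substP (cf P) v x
  cf-subst 𝟎 = refl
  cf-subst (inp c y t P) with x ≡ᵇ y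
  ... | true = refl
  ... | false = cong (inp c y t) (cf-subst P)
  cf-subst (out c e P) = cong (out c _) (cf-subst P)
  cf-subst (sel c s P) = cong (sel c s) (cf-subst P)
  cf-subst (bra c P Q) = cong₂ (bra c) (cf-subst P) (cf-subst Q)
  cf-subst (ifte e P Q) = cong₂ (ifte _) (cf-subst P) (cf-subst Q)
  cf-subst (P ⋈ Q) =
    trans (cong₂ (λ u w → build (norm (flat u ++ flat w))) (cf-subst P) (cf-subst Q))
    (trans (cong₂ (λ u w → build (norm (u ++ w))) (flat-subst (cf P)) (flat-subst (cf Q)))
    (trans (cong (λ u → build (norm u)) (sym (map-++ sub (flat (cf P)) (flat (cf Q)))))
    (trans (cong build (sym (map-norm sub (All-subst-preservesZero (flat (cf P) ++ flat (cf Q))))))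
           (sym (build-subst (norm (flat (cf P) ++ flat (cf Q))))))))

infix 4 _≃_
record _≃_ (xs ys : List Proc) : Set where
  constructor mk≃
  field ncf≡ : ncf xs ≡ ncf ys
open _≃_

≃-refl : ∀ {xs} → xs ≃ xs
≃-refl = mk≃ refl

≃-sym : ∀ {xs ys} → xs ≃ ys → ys ≃ xs
≃-sym (mk≃ e) = mk≃ (sym e)

≃-trans : ∀ {xs ys zs} → xs ≃ ys → ys ≃ zs → xs ≃ zs
≃-trans (mk≃ e) (mk≃ f) = mk≃ (trans e f)

ncf-++ : ∀ u w → ncf (u ++ w) ≡ norm (ncf u ++ ncf w)
ncf-++ u w = trans (cong norm (map-++ cf u w)) (norm-++ (map cf u) (map cf w))

≃-++ : ∀ {u u' w w'} → u ≃ u' → w ≃ w' → (u ++ w) ≃ (u' ++ w')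
≃-++ {u} {u'} {w} {w'} e f = mk≃ (trans (ncf-++ u w) (trans (cong₂ (λ a b → norm (a ++ b)) (ncf≡ e) (ncf≡ f)) (sym (ncf-++ u' w'))))

≃-≡ : ∀ {u w} → u ≡ w → u ≃ w
≃-≡ refl = mk≃ refl

all-cf-idem : ∀ xs → All (λ a → cf (cf a) ≡ cf a) xs
all-cf-idem [] = []
all-cf-idem (a ∷ xs) = cf-idem a ∷ all-cf-idem xs

ncf≃ : ∀ {xs} → All IsLeaf xs → ncf xs ≃ xs
ncf≃ {xs} ls = mk≃ (ncf-idem xs ls (all-cf-idem xs))

fcf≃ : ∀ R → flat (cf R) ≃ flat R
fcf≃ R = mk≃ (trans (cong ncf (flat-cf R)) (ncf≡ (ncf≃ (leaves-flat R))))

pick-cf : ∀ s P Q → pick s (cf P) (cf Q) ≡ cf (pick s P Q)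
pick-cf inl P Q = refl
pick-cf inr P Q = refl

if-cf : ∀ (b : Bool) P Q → (if b then cf P else cf Q) ≡ cf (if b then P else Q)
if-cf true P Q = refl
if-cf false P Q = refl

Tr-cf : ∀ {a c μ ca} → Tr a c μ ca → Σ _ λ ca' → Tr (cf a) c μ ca' × (ca' ≃ ca)
Tr-cf (tr-in {x = x} {P = P} {v = v} m) =
  _ , tr-in m , mk≃ (trans (cong (λ z → ncf (flat z)) (sym (cf-subst v x P))) (ncf≡ (fcf≃ (substP P v x))))
Tr-cf (tr-out {P = P} d) = _ , tr-out d , fcf≃ P
Tr-cf (tr-sel {P = P}) = _ , tr-sel , fcf≃ P
Tr-cf (tr-bra {s = s} {P} {Q}) = _ , tr-bra , mk≃ (trans (cong (λ z → ncf (flat z)) (pick-cf s P Q)) (ncf≡ (fcf≃ (pick s P Q))))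

Tr-cf⁻ : ∀ {a c μ ca'} → IsLeaf a → Tr (cf a) c μ ca' → Σ _ λ ca → Tr a c μ ca × (ca' ≃ ca)
Tr-cf⁻ (lfi {c} {x} {t} {P}) (tr-in m) = let (_ , _ , e) = Tr-cf (tr-in {c} {x} {t} {P} m) in _ , tr-in m , e
Tr-cf⁻ (lfo {c} {e'} {P}) (tr-out d) = let (_ , _ , e) = Tr-cf (tr-out {c} {e'} {P} d) in _ , tr-out d , e
Tr-cf⁻ (lfs {c} {s} {P}) tr-sel = let (_ , _ , e) = Tr-cf (tr-sel {c} {s} {P}) in _ , tr-sel , e
Tr-cf⁻ (lfb {c} {P} {Q}) (tr-bra {s = s}) = let (_ , _ , e) = Tr-cf (tr-bra {c} {s} {P} {Q}) in _ , tr-bra , e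

Tau-cf : ∀ {a ca} → Tau a ca → Σ _ λ ca' → Tau (cf a) ca' × (ca' ≃ ca)
Tau-cf (tau-if {P = P} {Q} {b} d) = _ , tau-if d , mk≃ (trans (cong (λ z → ncf (flat z)) (if-cf b P Q)) (ncf≡ (fcf≃ (if b then P else Q))))

Tau-cf⁻ : ∀ {a ca'} → IsLeaf a → Tau (cf a) ca' → Σ _ λ ca → Tau a ca × (ca' ≃ ca)
Tau-cf⁻ (lff {e'} {P} {Q}) (tau-if d) = let (_ , _ , e) = Tau-cf (tau-if {e'} {P} {Q} d) in _ , tau-if d , e

Tr-nz : ∀ {a c μ ca} → Tr a c μ ca → ¬ a ≡ 𝟎
Tr-nz (tr-in m) ()
Tr-nz (tr-out d) ()
Tr-nz tr-sel ()
Tr-nz tr-bra ()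

Tau-nz : ∀ {a ca} → Tau a ca → ¬ a ≡ 𝟎
Tau-nz (tau-if d) ()

Tr-leaves : ∀ {a c μ ca} → Tr a c μ ca → All IsLeaf ca
Tr-leaves (tr-in {x = x} {P = P} {v = v} m) = leaves-flat (substP P v x)
Tr-leaves (tr-out {P = P} d) = leaves-flat P
Tr-leaves (tr-sel {P = P}) = leaves-flat P
Tr-leaves (tr-bra {s = s} {P} {Q}) = leaves-flat (pick s P Q)

Tau-leaves : ∀ {a ca} → Tau a ca → All IsLeaf ca
Tau-leaves (tau-if {P = P} {Q} {b} d) = leaves-flat (if b then P else Q)

step-leaves : ∀ {xs ys} → All IsLeaf xs → xs ⟶ᶠ ys → All IsLeaf ys
step-leaves (_ ∷ _ ∷ ls) (sync t1 t2) = ++⁺ (Tr-leaves t1) (++⁺ (Tr-leaves t2) ls)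
step-leaves (_ ∷ ls) (silent τ) = ++⁺ (Tau-leaves τ) ls
step-leaves (la ∷ ls) (there s) = la ∷ step-leaves ls s

𝟎-step : ∀ {rest zs} → (𝟎 ∷ rest) ⟶ᶠ zs → Σ _ λ zs' → (zs ≡ 𝟎 ∷ zs') × (rest ⟶ᶠ zs')
𝟎-step (sync () _)
𝟎-step (silent ())
𝟎-step (there s) = _ , refl , s

cons𝟎-step : ∀ {L zs} → L ⟶ᶠ zs → Σ _ λ w → (cons 𝟎 L ⟶ᶠ w) × (ncf w ≡ cons 𝟎 (ncf zs))
cons𝟎-step {[]} ()
cons𝟎-step {b ∷ rest} s with isZero b
cons𝟎-step {.𝟎 ∷ rest} s | yes refl with 𝟎-step s
... | zs' , refl , s' = _ , s , sym (cons-idem (ncf zs'))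
cons𝟎-step {b ∷ rest} s | no nz = _ , (cons𝟎-nonzero b rest nz ≡▸ there s) , refl

ncf-step : ∀ {xs ys} → All IsLeaf xs → xs ⟶ᶠ ys → Σ _ λ zs → (ncf xs ⟶ᶠ zs) × (zs ≃ ys)
ncf-step (la ∷ lb ∷ ls) (sync {a} {b} {xs = xs} t1 t2) with Tr-cf t1 | Tr-cf t2
... | ca' , t1' , e1 | cb' , t2' , e2 =
  _ , (trans (cong (cons (cf a)) (cons-nonzero (cf b) (ncf xs) (Tr-nz t2'))) (cons-nonzero (cf a) _ (Tr-nz t1')) ≡▸ sync t1' t2') ,
  ≃-++ e1 (≃-++ e2 (ncf≃ ls))
ncf-step (la ∷ ls) (silent {a} {xs = xs} τ) with Tau-cf τ
... | ca' , τ' , e = _ , (cons-nonzero (cf a) (ncf xs) (Tau-nz τ') ≡▸ silent τ') , ≃-++ e (ncf≃ ls)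
ncf-step (la ∷ ls) (there {a} {xs} {ys} s) with ncf-step ls s | isZero (cf a)
... | zs , p , e | no nz = _ , (cons-nonzero (cf a) (ncf xs) nz ≡▸ there p) , mk≃ (cong₂ cons (cf-idem a) (ncf≡ e))
... | zs , p , e | yes z with cons𝟎-step p
...   | w , q , e' = w , (cong (λ u → cons u (ncf xs)) z ≡▸ q) , mk≃ (trans e' (trans (cong (cons 𝟎) (ncf≡ e)) (cong (λ u → cons u (ncf ys)) (sym z))))

ncf-head : ∀ xs {b' rest} → b' ∷ rest ≡ ncf xs → ¬ b' ≡ 𝟎 →
          Σ _ λ b → Σ _ λ xs'' → (xs ≡ b ∷ xs'') × (cf b ≡ b') × (rest ≡ ncf xs'')
ncf-head [] () nz
ncf-head (b ∷ xs'') eq nz with isZero (cf b)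
... | yes z with consHead (cf b) (ncf xs'')
...   | L' , eq' = ⊥-elim (nz (trans (proj₁ (∷-injective (trans eq eq'))) z))
ncf-head (b ∷ xs'') eq nz | no nz' with ∷-injective (trans eq (cons-nonzero (cf b) (ncf xs'') nz'))
... | e1 , e2 = b , xs'' , refl , sym e1 , e2

mutual
  ncf-step⁻ : ∀ xs {zs} → All IsLeaf xs → ncf xs ⟶ᶠ zs → Σ _ λ ys → (xs ⟶ᶠ ys) × (ys ≃ zs)
  ncf-step⁻ [] [] ()
  ncf-step⁻ (a ∷ xs) (la ∷ ls) s with isZero (cf a)
  ... | no nz = ncf-step⁻-nonzero a xs la ls nz (ncf xs) refl (sym (cons-nonzero (cf a) (ncf xs) nz) ≡▸ s)
  ... | yes z with ncf-step⁻-zero xs ls (ncf xs) refl (cong (λ u → cons u (ncf xs)) (sym z) ≡▸ s)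
  ...   | ys' , p , e = a ∷ ys' , there p , mk≃ (trans (cong (λ u → cons u (ncf ys')) z) e)

  ncf-step⁻-nonzero : ∀ a xs {zs} → IsLeaf a → All IsLeaf xs → ¬ cf a ≡ 𝟎 → ∀ L → L ≡ ncf xs → (cf a ∷ L) ⟶ᶠ zs →
          Σ _ λ ys → ((a ∷ xs) ⟶ᶠ ys) × (ys ≃ zs)
  ncf-step⁻-nonzero a xs la ls nz (b' ∷ rest) eq (sync t1 t2) with ncf-head xs eq (Tr-nz t2)
  ... | b , xs'' , refl , eb , er with ls
  ...   | lb ∷ ls'' with Tr-cf⁻ la t1 | Tr-cf⁻ lb (subst (λ z → Tr z l _ _) (sym eb) t2)
  ...     | ca , ta , e1 | cb , tb , e2 =
            _ , sync ta tb , ≃-sym (≃-++ e1 (≃-++ e2 (≃-trans (mk≃ (cong ncf er)) (ncf≃ ls''))))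
  ncf-step⁻-nonzero a xs la ls nz L eq (silent τ) with Tau-cf⁻ la τ
  ... | ca , τ' , e = _ , silent τ' , ≃-sym (≃-++ e (≃-trans (mk≃ (cong ncf eq)) (ncf≃ ls)))
  ncf-step⁻-nonzero a xs la ls nz L eq (there s) with ncf-step⁻ xs ls (sym eq ≡▸ s)
  ... | ys' , p , e = a ∷ ys' , there p , mk≃ (trans (cong (cons (cf a)) (ncf≡ e)) (cong (λ u → cons u _) (sym (cf-idem a))))

  ncf-step⁻-zero : ∀ xs {zs} → All IsLeaf xs → ∀ L → L ≡ ncf xs → cons 𝟎 L ⟶ᶠ zs →
         Σ _ λ ys' → (xs ⟶ᶠ ys') × (cons 𝟎 (ncf ys') ≡ ncf zs)
  ncf-step⁻-zero xs ls [] eq (silent ())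
  ncf-step⁻-zero xs ls [] eq (there ())
  ncf-step⁻-zero xs ls (b ∷ rest) eq s with isZero b
  ncf-step⁻-zero xs ls (.𝟎 ∷ rest) eq s | yes refl with ncf-step⁻ xs ls (sym eq ≡▸ s) | 𝟎-step s
  ... | ys' , p , e | zs' , refl , _ = ys' , p , trans (cong (cons 𝟎) (ncf≡ e)) (cons-idem (ncf zs'))
  ncf-step⁻-zero xs ls (b ∷ rest) eq s | no nz with 𝟎-step (sym (cons𝟎-nonzero b rest nz) ≡▸ s)
  ... | zs' , refl , s' with ncf-step⁻ xs ls (sym eq ≡▸ s')
  ...   | ys' , p , e = ys' , p , cong (cons 𝟎) (ncf≡ e)

≃-simulates : ∀ {xs xs' ys'} → All IsLeaf xs → All IsLeaf xs' → xs ≃ xs' → xs' ⟶ᶠ ys' → Σ _ λ ys → (xs ⟶ᶠ ys) × (ys ≃ ys')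
≃-simulates {xs} lxs lxs' e s with ncf-step lxs' s
... | zs , p , e1 with ncf-step⁻ xs lxs (ncf≡ e ≡▸ p)
...   | ys , q , e2 = ys , q , ≃-trans e2 e1

≃⇒cf≡ : ∀ {P Q} → flat P ≃ flat Q → cf P ≡ cf Q
≃⇒cf≡ {P} {Q} e = trans (sym (build-flat-cf P)) (trans (cong build (trans (flat-cf P) (trans (ncf≡ e) (sym (flat-cf Q))))) (build-flat-cf Q))

≡ₛ⇒≃ : ∀ {P Q} → P ≡ₛ Q → flat P ≃ flat Q
≡ₛ⇒≃ s-refl = ≃-refl
≡ₛ⇒≃ (s-sym e) = ≃-sym (≡ₛ⇒≃ e)
≡ₛ⇒≃ (s-trans e f) = ≃-trans (≡ₛ⇒≃ e) (≡ₛ⇒≃ f)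
≡ₛ⇒≃ (s-inp {P = P} {P'} e) = mk≃ (cong (λ z → inp _ _ _ z ∷ []) (≃⇒cf≡ {P} {P'} (≡ₛ⇒≃ e)))
≡ₛ⇒≃ (s-out {P = P} {P'} e) = mk≃ (cong (λ z → out _ _ z ∷ []) (≃⇒cf≡ {P} {P'} (≡ₛ⇒≃ e)))
≡ₛ⇒≃ (s-sel {P = P} {P'} e) = mk≃ (cong (λ z → sel _ _ z ∷ []) (≃⇒cf≡ {P} {P'} (≡ₛ⇒≃ e)))
≡ₛ⇒≃ (s-bra {P = P} {P'} {Q} {Q'} e f) = mk≃ (cong₂ (λ z w → bra _ z w ∷ []) (≃⇒cf≡ {P} {P'} (≡ₛ⇒≃ e)) (≃⇒cf≡ {Q} {Q'} (≡ₛ⇒≃ f)))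
≡ₛ⇒≃ (s-if {P = P} {P'} {Q} {Q'} e f) = mk≃ (cong₂ (λ z w → ifte _ z w ∷ []) (≃⇒cf≡ {P} {P'} (≡ₛ⇒≃ e)) (≃⇒cf≡ {Q} {Q'} (≡ₛ⇒≃ f)))
≡ₛ⇒≃ (s-par e f) = ≃-++ (≡ₛ⇒≃ e) (≡ₛ⇒≃ f)
≡ₛ⇒≃ s-unit = mk≃ refl
≡ₛ⇒≃ (s-assoc {P} {Q} {R}) = mk≃ (cong ncf (++-assoc (flat P) (flat Q) (flat R)))

-- Configurations simulate processes

leftOf rightOf : RCtx → List Proc
leftOf hole = []
leftOf (C ⋈ₗ Q) = leftOf C
leftOf (Q ⋈ᵣ C) = flat Q ++ leftOf C
rightOf hole = []
rightOf (C ⋈ₗ Q) = rightOf C ++ flat Q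
rightOf (Q ⋈ᵣ C) = rightOf C

flat-plug : ∀ C P → flat (plug C P) ≡ leftOf C ++ flat P ++ rightOf C
flat-plug hole P = sym (++-identityʳ (flat P))
flat-plug (C ⋈ₗ Q) P = trans (cong (_++ flat Q) (flat-plug C P))
  (trans (++-assoc (leftOf C) (flat P ++ rightOf C) (flat Q)) (cong (leftOf C ++_) (++-assoc (flat P) (rightOf C) (flat Q))))
flat-plug (Q ⋈ᵣ C) P = trans (cong (flat Q ++_) (flat-plug C P)) (sym (++-assoc (flat Q) (leftOf C) _))

⟶⇒⟶ᶠ : ∀ {X Y} → X ⟶ Y → Σ _ λ ys → (flat X ⟶ᶠ ys) × (ys ≃ flat Y)
⟶⇒⟶ᶠ (r-comm₁ {P = P} d m) = _ , sync (tr-out d) (tr-in m) , ≃-≡ (cong (flat P ++_) (++-identityʳ _))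
⟶⇒⟶ᶠ (r-comm₂ {Q = Q} d m) = _ , sync (tr-in m) (tr-out d) , ≃-≡ (cong (_ ++_) (++-identityʳ (flat Q)))
⟶⇒⟶ᶠ (r-sel₁ {P = P}) = _ , sync tr-sel tr-bra , ≃-≡ (cong (flat P ++_) (++-identityʳ _))
⟶⇒⟶ᶠ (r-sel₂ {Q = Q}) = _ , sync tr-bra tr-sel , ≃-≡ (cong (_ ++_) (++-identityʳ (flat Q)))
⟶⇒⟶ᶠ (r-if d) = _ , silent (tau-if d) , ≃-≡ (++-identityʳ _)
⟶⇒⟶ᶠ (r-ctx C {P} {Q} s) with ⟶⇒⟶ᶠ s
... | ys , p , e = _ , (flat-plug C P ≡▸ prefix-step (leftOf C) (suffix-step p (rightOf C))) ,
                   ≃-trans (≃-++ {u = leftOf C} ≃-refl (≃-++ {u = ys} e ≃-refl)) (mk≃ (cong ncf (sym (flat-plug C Q))))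
⟶⇒⟶ᶠ (r-struct {P} {P'} e₁ s e₂) with ⟶⇒⟶ᶠ s
... | ys' , p , e with ≃-simulates (leaves-flat P) (leaves-flat P') (≡ₛ⇒≃ e₁) p
...   | ys , q , e' = ys , q , ≃-trans e' (≃-trans e (≡ₛ⇒≃ e₂))

build-++ : ∀ xs ys → NonEmpty xs → NonEmpty ys → build (xs ++ ys) ≡ₛ (build xs ⋈ build ys)
build-++ (a ∷ []) (b ∷ ys) _ _ = s-refl
build-++ (a ∷ b ∷ xs) ys _ ney = s-trans (s-par s-refl (build-++ (b ∷ xs) ys tt ney)) (s-sym s-assoc)

≡ₛ-build-flat : ∀ X → X ≡ₛ build (flat X)
≡ₛ-build-flat 𝟎 = s-refl
≡ₛ-build-flat (inp c x t P) = s-refl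
≡ₛ-build-flat (out c e P) = s-refl
≡ₛ-build-flat (sel c s P) = s-refl
≡ₛ-build-flat (bra c P Q) = s-refl
≡ₛ-build-flat (ifte e P Q) = s-refl
≡ₛ-build-flat (P ⋈ Q) = s-trans (s-par (≡ₛ-build-flat P) (≡ₛ-build-flat Q)) (s-sym (build-++ (flat P) (flat Q) (NonEmpty-flat P) (NonEmpty-flat Q)))

sync⇒⟶ : ∀ {a b μ ca cb} → Tr a r μ ca → Tr b l (dualLabel μ) cb → Σ _ λ W → ((a ⋈ b) ⟶ W) × (flat W ≡ ca ++ cb)
sync⇒⟶ (tr-out d) (tr-in m) = _ , r-comm₁ d m , refl
sync⇒⟶ (tr-in m) (tr-out d) = _ , r-comm₂ d m , refl
sync⇒⟶ tr-sel tr-bra = _ , r-sel₁ , refl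
sync⇒⟶ tr-bra tr-sel = _ , r-sel₂ , refl

silent⇒⟶ : ∀ {a ca} → Tau a ca → Σ _ λ W → (a ⟶ W) × (flat W ≡ ca)
silent⇒⟶ (tau-if d) = _ , r-if d , refl

build-⟶ᶠ⇒⟶ : ∀ xs {ys} → All IsLeaf xs → xs ⟶ᶠ ys → Σ _ λ W → (build xs ⟶ W) × (flat W ≃ ys)
build-⟶ᶠ⇒⟶ (a ∷ b ∷ []) ls (sync {ca = ca} {cb} t1 t2) with sync⇒⟶ t1 t2
... | W , s , e = W , s , ≃-≡ (trans e (cong (ca ++_) (sym (++-identityʳ cb))))
build-⟶ᶠ⇒⟶ (a ∷ b ∷ c ∷ xs) (_ ∷ _ ∷ ls) (sync {ca = ca} {cb} t1 t2) with sync⇒⟶ t1 t2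
... | W , s , e = W ⋈ build (c ∷ xs) , r-struct (s-sym s-assoc) (r-ctx (hole ⋈ₗ build (c ∷ xs)) s) s-refl ,
                  ≃-≡ (trans (cong₂ _++_ e (flat-build (c ∷ xs) tt ls)) (++-assoc ca cb (c ∷ xs)))
build-⟶ᶠ⇒⟶ (a ∷ []) ls (silent τ) with silent⇒⟶ τ
... | W , s , e = W , s , ≃-≡ (trans e (sym (++-identityʳ _)))
build-⟶ᶠ⇒⟶ (a ∷ c ∷ xs) (_ ∷ ls) (silent τ) with silent⇒⟶ τ
... | W , s , e = W ⋈ build (c ∷ xs) , r-ctx (hole ⋈ₗ build (c ∷ xs)) s , ≃-≡ (cong₂ _++_ e (flat-build (c ∷ xs) tt ls))
build-⟶ᶠ⇒⟶ (a ∷ c ∷ xs) (la ∷ ls) (there s) with build-⟶ᶠ⇒⟶ (c ∷ xs) ls s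
... | W , p , e = a ⋈ W , r-ctx (a ⋈ᵣ hole) p , mk≃ (trans (cong (λ z → ncf (z ++ flat W)) (flat-leaf la)) (cong (cons (cf a)) (ncf≡ e)))

⟶ᶠ⇒⟶ : ∀ X {ys} → flat X ⟶ᶠ ys → Σ _ λ Y → (X ⟶ Y) × (flat Y ≃ ys)
⟶ᶠ⇒⟶ X p with build-⟶ᶠ⇒⟶ (flat X) (leaves-flat X) p
... | W , s , e = W , r-struct (≡ₛ-build-flat X) s s-refl , e

All𝟎⇒≡ₛ𝟎 : ∀ X → All𝟎 (flat X) → X ≡ₛ 𝟎
All𝟎⇒≡ₛ𝟎 𝟎 _ = s-refl
All𝟎⇒≡ₛ𝟎 (inp c x t P) (() ∷ _)
All𝟎⇒≡ₛ𝟎 (out c e P) (() ∷ _)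
All𝟎⇒≡ₛ𝟎 (sel c s P) (() ∷ _)
All𝟎⇒≡ₛ𝟎 (bra c P Q) (() ∷ _)
All𝟎⇒≡ₛ𝟎 (ifte e P Q) (() ∷ _)
All𝟎⇒≡ₛ𝟎 (P ⋈ Q) z = let (zp , zq) = ++⁻ (flat P) z in s-trans (s-par (All𝟎⇒≡ₛ𝟎 P zp) (All𝟎⇒≡ₛ𝟎 Q zq)) s-unit

All𝟎-ncf⁻ : ∀ {xs} → All IsLeaf xs → All𝟎 (ncf xs) → All𝟎 xs
All𝟎-ncf⁻ {xs} ls z = go ls (All𝟎-norm (map cf xs) z)
  where go : ∀ {xs} → All IsLeaf xs → All𝟎 (map cf xs) → All𝟎 xs
        go [] [] = []
        go (lf ∷ ls) (p ∷ ps) = proj₂ (cf-preservesZero lf) p ∷ go ls ps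

All𝟎-ncf : ∀ {xs} → All IsLeaf xs → All𝟎 xs → All𝟎 (ncf xs)
All𝟎-ncf ls z = norm-All (go ls z)
  where go : ∀ {xs} → All IsLeaf xs → All𝟎 xs → All𝟎 (map cf xs)
        go [] [] = []
        go (lf ∷ ls) (p ∷ ps) = proj₁ (cf-preservesZero lf) p ∷ go ls ps

≃-All𝟎 : ∀ {xs ys} → All IsLeaf xs → All IsLeaf ys → xs ≃ ys → All𝟎 xs → All𝟎 ys
≃-All𝟎 lx ly e z = All𝟎-ncf⁻ ly (subst All𝟎 (ncf≡ e) (All𝟎-ncf lx z))

≡ₛ𝟎⇒All𝟎 : ∀ {X} → X ≡ₛ 𝟎 → All𝟎 (flat X)
≡ₛ𝟎⇒All𝟎 {X} e = ≃-All𝟎 (lf0 ∷ []) (leaves-flat X) (≃-sym (≡ₛ⇒≃ e)) (refl ∷ [])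

Correct⇒Correctᶠ : ∀ X xs → All IsLeaf xs → Correct X → xs ≃ flat X → Correctᶠ xs
Correct⇒Correctᶠ X xs lxs c e ys done st = ≃-All𝟎 (leaves-flat X) lxs (≃-sym e) (≡ₛ𝟎⇒All𝟎 (c X ε stX))
  where stX : Stuck X
        stX R s with ⟶⇒⟶ᶠ s
        ... | ys' , p , _ with ≃-simulates lxs (leaves-flat X) e p
        ...   | _ , q , _ = st _ q
Correct⇒Correctᶠ X xs lxs c e ys (s ∷s run) st with ≃-simulates (leaves-flat X) lxs (≃-sym e) s
... | zs , p , e1 with ⟶ᶠ⇒⟶ X p
...   | Y , sY , e2 = Correct⇒Correctᶠ Y _ (step-leaves lxs s) (λ Q run' st' → c Q (sY ◅ run') st') (≃-sym (≃-trans e2 e1)) ys run st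

Correctᶠ⇒Correct : ∀ X xs → All IsLeaf xs → Correctᶠ xs → xs ≃ flat X → Correct X
Correctᶠ⇒Correct X xs lxs c e Q ε stQ = All𝟎⇒≡ₛ𝟎 X (≃-All𝟎 lxs (leaves-flat X) e (c xs done stxs))
  where stxs : Stuckᶠ xs
        stxs ys s with ≃-simulates (leaves-flat X) lxs (≃-sym e) s
        ... | _ , p , _ with ⟶ᶠ⇒⟶ X p
        ...   | _ , q , _ = stQ _ q
Correctᶠ⇒Correct X xs lxs c e Q (s ◅ run) stQ with ⟶⇒⟶ᶠ s
... | ys , p , e1 with ≃-simulates lxs (leaves-flat X) e p
...   | ws , q , e2 = Correctᶠ⇒Correct _ ws (step-leaves lxs q) (Correctᶠ-step c q) (≃-trans e2 e1) Q run stQ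

Correct⇔Correctᶠ : ∀ X → Correct X ⇔ Correctᶠ (flat X)
Correct⇔Correctᶠ X = mk⇔ (λ c → Correct⇒Correctᶠ X (flat X) (leaves-flat X) c ≃-refl)
                          (λ c → Correctᶠ⇒Correct X (flat X) (leaves-flat X) c ≃-refl)

≈ᶠ⇒≈ : ∀ {P Q} → flat P ≈ᶠ flat Q → P ≈ Q
≈ᶠ⇒≈ {P} {Q} e C =
  ⇔.trans (Correct⇔Correctᶠ (plug C P)) (⇔.trans (≡⇒⇔ (flat-plug C P))
  (⇔.trans (e (leftOf C) (rightOf C))
  (⇔.trans (≡⇒⇔ (sym (flat-plug C Q))) (⇔.sym (Correct⇔Correctᶠ (plug C Q))))))

∷-++-[] : ∀ (x : Proc) xs → x ∷ (xs ++ []) ≡ x ∷ xs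
∷-++-[] x xs = cong (x ∷_) (++-identityʳ xs)

-- idP rebinds variable 0 before each use of it, hence is closed.
idP-closed : ∀ T v x → substP (idP T) v x ≡ idP T
idP-closed end v x = refl
idP-closed (¿ t ∙ T) v zero = refl
idP-closed (¿ t ∙ T) v (suc x) = cong (λ P → inp r 0 t (out l (var 0) P)) (idP-closed T v (suc x))
idP-closed (! t ∙ T) v zero = refl
idP-closed (! t ∙ T) v (suc x) = cong (λ P → inp l 0 t (out r (var 0) P)) (idP-closed T v (suc x))
idP-closed (T & S) v x = cong₂ (λ P Q → bra r (sel l inl P) (sel l inr Q)) (idP-closed T v x) (idP-closed S v x)
idP-closed (T ⊕ S) v x = cong₂ (λ P Q → bra l (sel r inl P) (sel r inr Q)) (idP-closed T v x) (idP-closed S v x)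

idP-typed : ∀ {Γ} T → Γ ⊢ idP T ▷ (dual T , T)
idP-typed end = t-nil
idP-typed (! t ∙ T) = t-inp (t-out (t-var refl) (idP-typed T))
idP-typed (¿ t ∙ T) = t-inp (t-out (t-var refl) (idP-typed T))
idP-typed (T ⊕ S) = t-bra (t-inl (idP-typed T)) (t-inr (idP-typed S))
idP-typed (T & S) = t-bra (t-inl (idP-typed T)) (t-inr (idP-typed S))

idP-idem : ∀ T → (flat (idP T) ++ flat (idP T)) ≈ᶠ flat (idP T)
idP-idem end = 𝟎𝟎≈ᶠ𝟎
idP-idem (! t ∙ T) =
  extrudeˡ-inp (idP (! t ∙ T)) 0 t (out r (var 0) (idP T)) (λ v → idP-closed (! t ∙ T) v 0) ⨾ inp-cong forward
  where forward : ∀ v → v ∈ᵥ t → flat (substP (out r (var 0) (idP T) ⋈ idP (! t ∙ T)) v 0) ≈ᶠ flat (substP (out r (var 0) (idP T)) v 0)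
        forward v v∈t rewrite idP-closed T v 0 =
          ≈ᶠ-step≡ (sync (tr-out ⇓val) (tr-in v∈t)) (cong (λ P → flat (idP T) ++ out r (val v) P ∷ []) (idP-closed T v 0))
          ⨾ extrudeʳ-out (idP T) (val v) (idP T) ⨾ out-cong (idP-idem T)
idP-idem (¿ t ∙ T) =
  extrudeʳ-inp (idP (¿ t ∙ T)) 0 t (out l (var 0) (idP T)) (λ v → idP-closed (¿ t ∙ T) v 0) ⨾ inp-cong forward
  where forward : ∀ v → v ∈ᵥ t → flat (substP (idP (¿ t ∙ T) ⋈ out l (var 0) (idP T)) v 0) ≈ᶠ flat (substP (out l (var 0) (idP T)) v 0)
        forward v v∈t rewrite idP-closed T v 0 =
          ≈ᶠ-step≡ (sync (tr-in v∈t) (tr-out ⇓val))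
                   (trans (cong (λ P → out l (val v) P ∷ flat (idP T) ++ []) (idP-closed T v 0)) (∷-++-[] _ _))
          ⨾ extrudeˡ-out (idP T) (val v) (idP T) ⨾ out-cong (idP-idem T)
idP-idem (T ⊕ S) =
  extrudeˡ-bra (idP (T ⊕ S)) (sel r inl (idP T)) (sel r inr (idP S)) ⨾ bra-cong (forward inl) (forward inr)
  where forward : ∀ ℓ → (sel r ℓ (pick ℓ (idP T) (idP S)) ∷ idP (T ⊕ S) ∷ []) ≈ᶠ [ sel r ℓ (pick ℓ (idP T) (idP S)) ]
        forward inl = ≈ᶠ-step (sync tr-sel (tr-bra {s = inl})) ⨾ extrudeʳ-sel (idP T) inl (idP T) ⨾ sel-cong (idP-idem T)
        forward inr = ≈ᶠ-step (sync tr-sel (tr-bra {s = inr})) ⨾ extrudeʳ-sel (idP S) inr (idP S) ⨾ sel-cong (idP-idem S)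
idP-idem (T & S) =
  extrudeʳ-bra (idP (T & S)) (sel l inl (idP T)) (sel l inr (idP S)) ⨾ bra-cong (forward inl) (forward inr)
  where forward : ∀ ℓ → (idP (T & S) ∷ sel l ℓ (pick ℓ (idP T) (idP S)) ∷ []) ≈ᶠ [ sel l ℓ (pick ℓ (idP T) (idP S)) ]
        forward inl = ≈ᶠ-step≡ (sync (tr-bra {s = inl}) tr-sel) (∷-++-[] _ _) ⨾ extrudeˡ-sel (idP T) inl (idP T) ⨾ sel-cong (idP-idem T)
        forward inr = ≈ᶠ-step≡ (sync (tr-bra {s = inr}) tr-sel) (∷-++-[] _ _) ⨾ extrudeˡ-sel (idP S) inr (idP S) ⨾ sel-cong (idP-idem S)

idP-outʳ : ∀ T e → (flat (idP T) ++ [ out r e (idP T) ]) ≈ᶠ [ out r e (idP T) ]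
idP-outʳ T e = extrudeʳ-out (idP T) e (idP T) ⨾ out-cong (idP-idem T)

idP-selʳ : ∀ T ℓ → (flat (idP T) ++ [ sel r ℓ (idP T) ]) ≈ᶠ [ sel r ℓ (idP T) ]
idP-selʳ T ℓ = extrudeʳ-sel (idP T) ℓ (idP T) ⨾ sel-cong (idP-idem T)

-- The laws (a1), (a3), (a5), (a7), (a9) and (a11)

swapOut : BType → BType → SType → Proc
swapOut t s T = inp l 0 t (inp l 1 s (out r (var 1) (out r (var 0) (idP T))))

swapOut-swapOut : ∀ t s T → (swapOut t s T ∷ swapOut s t T ∷ []) ≈ᶠ flat (idP (! t ∙ (! s ∙ T)))
swapOut-swapOut t s T =
  extrudeˡ-inp (swapOut s t T) 0 t (inp l 1 s (out r (var 1) (out r (var 0) I))) (λ _ → refl) ⨾ inp-cong afterFirst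
  where
  I = idP T
  afterFirst : ∀ v → v ∈ᵥ t → flat (substP (inp l 1 s (out r (var 1) (out r (var 0) I)) ⋈ swapOut s t T) v 0)
                              ≈ᶠ flat (substP (out r (var 0) (inp l 0 s (out r (var 0) I))) v 0)
  afterFirst v v∈t rewrite idP-closed T v 0 =
    extrudeˡ-inp (swapOut s t T) 1 s (out r (var 1) (out r (val v) I)) (λ _ → refl)
    ⨾ inp-cong afterSecond ⨾ swap-inpˡ-outʳ 0 s v (out r (var 0) I)
    where
    afterSecond : ∀ w → w ∈ᵥ s → flat (substP (out r (var 1) (out r (val v) I) ⋈ swapOut s t T) w 1)
                                 ≈ᶠ flat (substP (out r (val v) (out r (var 0) I)) w 0)
    afterSecond w w∈s rewrite idP-closed T w 1 | idP-closed T w 0 =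
      ≈ᶠ-step≡ (sync (tr-out ⇓val) (tr-in w∈s))
               (cong (λ P → out r (val v) I ∷ inp l 1 t (out r (var 1) (out r (val w) P)) ∷ []) (idP-closed T w 0))
      ⨾ ≈ᶠ-step≡ (sync (tr-out ⇓val) (tr-in v∈t))
                 (cong (λ P → flat I ++ out r (val v) (out r (val w) P) ∷ []) (idP-closed T v 1))
      ⨾ extrudeʳ-out I (val v) (out r (val w) I) ⨾ out-cong (idP-outʳ T (val w))

pushOut pullOut : BType → SType → SType → Proc
pushOut t T S = inp l 0 t (bra l (sel r inl (out r (var 0) (idP T))) (sel r inr (out r (var 0) (idP S))))
pullOut t T S = bra l (inp l 0 t (out r (var 0) (sel r inl (idP T)))) (inp l 0 t (out r (var 0) (sel r inr (idP S))))

pushOut-pullOut : ∀ t T S → (pushOut t T S ∷ pullOut t T S ∷ []) ≈ᶠ flat (idP (! t ∙ (T ⊕ S)))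
pushOut-pullOut t T S =
  extrudeˡ-inp (pullOut t T S) 0 t (bra l (sel r inl (out r (var 0) IT)) (sel r inr (out r (var 0) IS))) (λ _ → refl)
  ⨾ inp-cong afterValue
  where
  IT = idP T
  IS = idP S
  afterValue : ∀ v → v ∈ᵥ t → flat (substP (bra l (sel r inl (out r (var 0) IT)) (sel r inr (out r (var 0) IS)) ⋈ pullOut t T S) v 0)
                              ≈ᶠ flat (substP (out r (var 0) (bra l (sel r inl IT) (sel r inr IS))) v 0)
  afterValue v v∈t rewrite idP-closed T v 0 | idP-closed S v 0 =
    extrudeˡ-bra (pullOut t T S) (sel r inl (out r (val v) IT)) (sel r inr (out r (val v) IS))
    ⨾ bra-cong afterInl afterInr ⨾ swap-braˡ-outʳ v (sel r inl IT) (sel r inr IS)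
    where
    afterInl : (sel r inl (out r (val v) IT) ∷ pullOut t T S ∷ []) ≈ᶠ [ out r (val v) (sel r inl IT) ]
    afterInl = ≈ᶠ-step (sync tr-sel (tr-bra {s = inl}))
               ⨾ ≈ᶠ-step≡ (sync (tr-out ⇓val) (tr-in v∈t)) (cong (λ P → flat IT ++ out r (val v) (sel r inl P) ∷ []) (idP-closed T v 0))
               ⨾ extrudeʳ-out IT (val v) (sel r inl IT) ⨾ out-cong (idP-selʳ T inl)
    afterInr : (sel r inr (out r (val v) IS) ∷ pullOut t T S ∷ []) ≈ᶠ [ out r (val v) (sel r inr IS) ]
    afterInr = ≈ᶠ-step (sync tr-sel (tr-bra {s = inr}))
               ⨾ ≈ᶠ-step≡ (sync (tr-out ⇓val) (tr-in v∈t)) (cong (λ P → flat IS ++ out r (val v) (sel r inr P) ∷ []) (idP-closed S v 0))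
               ⨾ extrudeʳ-out IS (val v) (sel r inr IS) ⨾ out-cong (idP-selʳ S inr)

pullOut-pushOut : ∀ t T S → (pullOut t T S ∷ pushOut t T S ∷ []) ≈ᶠ flat (idP ((! t ∙ T) ⊕ (! t ∙ S)))
pullOut-pushOut t T S =
  extrudeˡ-bra (pushOut t T S) (inp l 0 t (out r (var 0) (sel r inl IT))) (inp l 0 t (out r (var 0) (sel r inr IS)))
  ⨾ bra-cong (afterChoice inl) (afterChoice inr)
  where
  IT = idP T
  IS = idP S
  pushOut-subst : ∀ v → substP (bra l (sel r inl (out r (var 0) IT)) (sel r inr (out r (var 0) IS))) v 0
                      ≡ bra l (sel r inl (out r (val v) IT)) (sel r inr (out r (val v) IS))
  pushOut-subst v = cong₂ (λ P Q → bra l (sel r inl (out r (val v) P)) (sel r inr (out r (val v) Q))) (idP-closed T v 0) (idP-closed S v 0)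
  afterValue : ∀ ℓ v → v ∈ᵥ t → flat (substP (out r (var 0) (sel r ℓ (pick ℓ IT IS)) ⋈ pushOut t T S) v 0)
                                ≈ᶠ flat (substP (sel r ℓ (out r (var 0) (pick ℓ IT IS))) v 0)
  afterValue inl v v∈t rewrite idP-closed T v 0 =
    ≈ᶠ-step≡ (sync (tr-out ⇓val) (tr-in v∈t)) (cong (λ P → sel r inl IT ∷ P ∷ []) (pushOut-subst v))
    ⨾ ≈ᶠ-step (sync tr-sel (tr-bra {s = inl})) ⨾ extrudeʳ-sel IT inl (out r (val v) IT) ⨾ sel-cong (idP-outʳ T (val v))
  afterValue inr v v∈t rewrite idP-closed S v 0 =
    ≈ᶠ-step≡ (sync (tr-out ⇓val) (tr-in v∈t)) (cong (λ P → sel r inr IS ∷ P ∷ []) (pushOut-subst v))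
    ⨾ ≈ᶠ-step (sync tr-sel (tr-bra {s = inr})) ⨾ extrudeʳ-sel IS inr (out r (val v) IS) ⨾ sel-cong (idP-outʳ S (val v))
  afterChoice : ∀ ℓ → (inp l 0 t (out r (var 0) (sel r ℓ (pick ℓ IT IS))) ∷ pushOut t T S ∷ [])
                      ≈ᶠ [ sel r ℓ (inp l 0 t (out r (var 0) (pick ℓ IT IS))) ]
  afterChoice ℓ =
    extrudeˡ-inp (pushOut t T S) 0 t (out r (var 0) (sel r ℓ (pick ℓ IT IS))) (λ _ → refl)
    ⨾ inp-cong (afterValue ℓ) ⨾ swap-inpˡ-selʳ 0 t ℓ (out r (var 0) (pick ℓ IT IS))

dropUnitOut addUnitOut : SType → Proc
dropUnitOut T = inp l 0 unit (idP T)
addUnitOut T = out r (val unitV) (idP T)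

dropUnitOut-addUnitOut : ∀ T → (dropUnitOut T ∷ addUnitOut T ∷ []) ≈ᶠ flat (idP (! unit ∙ T))
dropUnitOut-addUnitOut T =
  extrudeˡ-inp (addUnitOut T) 0 unit (idP T) (λ v → cong (out r (val unitV)) (idP-closed T v 0)) ⨾ inp-cong afterUnit
  where afterUnit : ∀ v → v ∈ᵥ unit → flat (substP (idP T ⋈ addUnitOut T) v 0) ≈ᶠ flat (substP (out r (var 0) (idP T)) v 0)
        afterUnit .unitV unit∈ rewrite idP-closed T unitV 0 = idP-outʳ T (val unitV)

addUnitOut-dropUnitOut : ∀ T → (addUnitOut T ∷ dropUnitOut T ∷ []) ≈ᶠ flat (idP T)
addUnitOut-dropUnitOut T =
  ≈ᶠ-step≡ (sync (tr-out ⇓val) (tr-in unit∈)) (cong (flat (idP T) ++_) (trans (++-identityʳ _) (cong flat (idP-closed T unitV 0))))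
  ⨾ idP-idem T

boolToSel selToBool : SType → Proc
boolToSel T = inp l 0 bool (ifte (var 0) (sel r inl (idP T)) (sel r inr (idP T)))
selToBool T = bra l (out r (val (boolV true)) (idP T)) (out r (val (boolV false)) (idP T))

boolToSel-selToBool : ∀ T → (boolToSel T ∷ selToBool T ∷ []) ≈ᶠ flat (idP (! bool ∙ T))
boolToSel-selToBool T =
  extrudeˡ-inp (selToBool T) 0 bool (ifte (var 0) (sel r inl I) (sel r inr I))
    (λ v → cong₂ (λ P Q → bra l (out r (val (boolV true)) P) (out r (val (boolV false)) Q)) (idP-closed T v 0) (idP-closed T v 0))
  ⨾ inp-cong afterBool
  where
  I = idP T
  afterBool : ∀ v → v ∈ᵥ bool → flat (substP (ifte (var 0) (sel r inl I) (sel r inr I) ⋈ selToBool T) v 0)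
                                ≈ᶠ flat (substP (out r (var 0) I) v 0)
  afterBool (boolV true) bool∈ rewrite idP-closed T (boolV true) 0 =
    ≈ᶠ-step (silent (tau-if ⇓val)) ⨾ ≈ᶠ-step (sync tr-sel (tr-bra {s = inl})) ⨾ idP-outʳ T (val (boolV true))
  afterBool (boolV false) bool∈ rewrite idP-closed T (boolV false) 0 =
    ≈ᶠ-step (silent (tau-if ⇓val)) ⨾ ≈ᶠ-step (sync tr-sel (tr-bra {s = inr})) ⨾ idP-outʳ T (val (boolV false))

selToBool-boolToSel : ∀ T → (selToBool T ∷ boolToSel T ∷ []) ≈ᶠ flat (idP (T ⊕ T))
selToBool-boolToSel T =
  extrudeˡ-bra (boolToSel T) (out r (val (boolV true)) I) (out r (val (boolV false)) I) ⨾ bra-cong (afterChoice inl) (afterChoice inr)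
  where
  I = idP T
  isInl : Sel → Bool
  isInl inl = true
  isInl inr = false
  ifte-subst : ∀ b → substP (ifte (var 0) (sel r inl I) (sel r inr I)) (boolV b) 0 ≡ ifte (val (boolV b)) (sel r inl I) (sel r inr I)
  ifte-subst b = cong₂ (λ P Q → ifte (val (boolV b)) (sel r inl P) (sel r inr Q)) (idP-closed T (boolV b) 0) (idP-closed T (boolV b) 0)
  afterChoice : ∀ ℓ → (out r (val (boolV (isInl ℓ))) I ∷ boolToSel T ∷ []) ≈ᶠ [ sel r ℓ I ]
  afterChoice inl =
    ≈ᶠ-step≡ (sync (tr-out ⇓val) (tr-in bool∈)) (cong (λ P → flat I ++ P ∷ []) (ifte-subst true))
    ⨾ ≈ᶠ-step (prefix-step (flat I) (silent (tau-if ⇓val))) ⨾ idP-selʳ T inl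
  afterChoice inr =
    ≈ᶠ-step≡ (sync (tr-out ⇓val) (tr-in bool∈)) (cong (λ P → flat I ++ P ∷ []) (ifte-subst false))
    ⨾ ≈ᶠ-step (prefix-step (flat I) (silent (tau-if ⇓val))) ⨾ idP-selʳ T inr

swapSel : SType → SType → Proc
swapSel T S = bra l (sel r inr (idP T)) (sel r inl (idP S))

swapSel-swapSel : ∀ T S → (swapSel T S ∷ swapSel S T ∷ []) ≈ᶠ flat (idP (T ⊕ S))
swapSel-swapSel T S = extrudeˡ-bra (swapSel S T) (sel r inr (idP T)) (sel r inl (idP S)) ⨾ bra-cong viaInr viaInl
  where
  viaInr : (sel r inr (idP T) ∷ swapSel S T ∷ []) ≈ᶠ [ sel r inl (idP T) ]
  viaInr = ≈ᶠ-step (sync tr-sel (tr-bra {s = inr})) ⨾ idP-selʳ T inl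
  viaInl : (sel r inl (idP S) ∷ swapSel S T ∷ []) ≈ᶠ [ sel r inr (idP S) ]
  viaInl = ≈ᶠ-step (sync tr-sel (tr-bra {s = inl})) ⨾ idP-selʳ S inr

module _ (T₁ T₂ T₃ : SType) where
  private
    I₁ = idP T₁
    I₂ = idP T₂
    I₃ = idP T₃

  assocSel unassocSel : Proc
  assocSel = bra l (bra l (sel r inl I₁) (sel r inr (sel r inl I₂))) (sel r inr (sel r inr I₃))
  unassocSel = bra l (sel r inl (sel r inl I₁)) (bra l (sel r inl (sel r inr I₂)) (sel r inr I₃))

  assocSel-unassocSel : (assocSel ∷ unassocSel ∷ []) ≈ᶠ flat (idP ((T₁ ⊕ T₂) ⊕ T₃))
  assocSel-unassocSel =
    extrudeˡ-bra unassocSel (bra l (sel r inl I₁) (sel r inr (sel r inl I₂))) (sel r inr (sel r inr I₃))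
    ⨾ bra-cong via₁₂ via₃
    where
    via₁ : (sel r inl I₁ ∷ unassocSel ∷ []) ≈ᶠ [ sel r inl (sel r inl I₁) ]
    via₁ = ≈ᶠ-step (sync tr-sel (tr-bra {s = inl})) ⨾ extrudeʳ-sel I₁ inl (sel r inl I₁) ⨾ sel-cong (idP-selʳ T₁ inl)
    via₂ : (sel r inr (sel r inl I₂) ∷ unassocSel ∷ []) ≈ᶠ [ sel r inl (sel r inr I₂) ]
    via₂ = ≈ᶠ-step (sync tr-sel (tr-bra {s = inr})) ⨾ ≈ᶠ-step (sync tr-sel (tr-bra {s = inl}))
           ⨾ extrudeʳ-sel I₂ inl (sel r inr I₂) ⨾ sel-cong (idP-selʳ T₂ inr)
    via₁₂ : (bra l (sel r inl I₁) (sel r inr (sel r inl I₂)) ∷ unassocSel ∷ []) ≈ᶠ [ sel r inl (bra l (sel r inl I₁) (sel r inr I₂)) ]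
    via₁₂ = extrudeˡ-bra unassocSel (sel r inl I₁) (sel r inr (sel r inl I₂))
            ⨾ bra-cong via₁ via₂ ⨾ swap-braˡ-selʳ inl (sel r inl I₁) (sel r inr I₂)
    via₃ : (sel r inr (sel r inr I₃) ∷ unassocSel ∷ []) ≈ᶠ [ sel r inr I₃ ]
    via₃ = ≈ᶠ-step (sync tr-sel (tr-bra {s = inr})) ⨾ ≈ᶠ-step (sync tr-sel (tr-bra {s = inr})) ⨾ idP-selʳ T₃ inr

  unassocSel-assocSel : (unassocSel ∷ assocSel ∷ []) ≈ᶠ flat (idP (T₁ ⊕ (T₂ ⊕ T₃)))
  unassocSel-assocSel =
    extrudeˡ-bra assocSel (sel r inl (sel r inl I₁)) (bra l (sel r inl (sel r inr I₂)) (sel r inr I₃))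
    ⨾ bra-cong via₁ via₂₃
    where
    via₁ : (sel r inl (sel r inl I₁) ∷ assocSel ∷ []) ≈ᶠ [ sel r inl I₁ ]
    via₁ = ≈ᶠ-step (sync tr-sel (tr-bra {s = inl})) ⨾ ≈ᶠ-step (sync tr-sel (tr-bra {s = inl})) ⨾ idP-selʳ T₁ inl
    via₂ : (sel r inl (sel r inr I₂) ∷ assocSel ∷ []) ≈ᶠ [ sel r inr (sel r inl I₂) ]
    via₂ = ≈ᶠ-step (sync tr-sel (tr-bra {s = inl})) ⨾ ≈ᶠ-step (sync tr-sel (tr-bra {s = inr}))
           ⨾ extrudeʳ-sel I₂ inr (sel r inl I₂) ⨾ sel-cong (idP-selʳ T₂ inl)
    via₃ : (sel r inr I₃ ∷ assocSel ∷ []) ≈ᶠ [ sel r inr (sel r inr I₃) ]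
    via₃ = ≈ᶠ-step (sync tr-sel (tr-bra {s = inr})) ⨾ extrudeʳ-sel I₃ inr (sel r inr I₃) ⨾ sel-cong (idP-selʳ T₃ inr)
    via₂₃ : (bra l (sel r inl (sel r inr I₂)) (sel r inr I₃) ∷ assocSel ∷ []) ≈ᶠ [ sel r inr (bra l (sel r inl I₂) (sel r inr I₃)) ]
    via₂₃ = extrudeˡ-bra assocSel (sel r inl (sel r inr I₂)) (sel r inr I₃)
            ⨾ bra-cong via₂ via₃ ⨾ swap-braˡ-selʳ inr (sel r inl I₂) (sel r inr I₃)

mk≅ : ∀ {T S} A B → [] ⊢ A ▷ (dual T , S) → [] ⊢ B ▷ (dual S , T) →
      (flat A ++ flat B) ≈ᶠ flat (idP T) → (flat B ++ flat A) ≈ᶠ flat (idP S) → T ≅ S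
mk≅ A B ⊢A ⊢B AB BA = A , B , ⊢A , ⊢B , ≈ᶠ⇒≈ AB , ≈ᶠ⇒≈ BA

!-comm : ∀ t s T → (! t ∙ (! s ∙ T)) ≅ (! s ∙ (! t ∙ T))
!-comm t s T = mk≅ (swapOut t s T) (swapOut s t T) (⊢swapOut t s) (⊢swapOut s t) (swapOut-swapOut t s T) (swapOut-swapOut s t T)
  where ⊢swapOut : ∀ t s → [] ⊢ swapOut t s T ▷ (dual (! t ∙ (! s ∙ T)) , ! s ∙ (! t ∙ T))
        ⊢swapOut t s = t-inp (t-inp (t-out (t-var refl) (t-out (t-var refl) (idP-typed T))))

!-distrib-⊕ : ∀ t T S → (! t ∙ (T ⊕ S)) ≅ ((! t ∙ T) ⊕ (! t ∙ S))
!-distrib-⊕ t T S = mk≅ (pushOut t T S) (pullOut t T S)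
  (t-inp (t-bra (t-inl (t-out (t-var refl) (idP-typed T))) (t-inr (t-out (t-var refl) (idP-typed S)))))
  (t-bra (t-inp (t-out (t-var refl) (t-inl (idP-typed T)))) (t-inp (t-out (t-var refl) (t-inr (idP-typed S)))))
  (pushOut-pullOut t T S) (pullOut-pushOut t T S)

!unit≅ : ∀ T → (! unit ∙ T) ≅ T
!unit≅ T = mk≅ (dropUnitOut T) (addUnitOut T) (t-inp (idP-typed T)) (t-out (t-val unit∈) (idP-typed T))
  (dropUnitOut-addUnitOut T) (addUnitOut-dropUnitOut T)

!bool≅⊕ : ∀ T → (! bool ∙ T) ≅ (T ⊕ T)
!bool≅⊕ T = mk≅ (boolToSel T) (selToBool T)
  (t-inp (t-if (t-var refl) (t-inl (idP-typed T)) (t-inr (idP-typed T))))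
  (t-bra (t-out (t-val bool∈) (idP-typed T)) (t-out (t-val bool∈) (idP-typed T)))
  (boolToSel-selToBool T) (selToBool-boolToSel T)

⊕-comm : ∀ T S → (T ⊕ S) ≅ (S ⊕ T)
⊕-comm T S = mk≅ (swapSel T S) (swapSel S T) (⊢swapSel T S) (⊢swapSel S T) (swapSel-swapSel T S) (swapSel-swapSel S T)
  where ⊢swapSel : ∀ T S → [] ⊢ swapSel T S ▷ (dual (T ⊕ S) , S ⊕ T)
        ⊢swapSel T S = t-bra (t-inr (idP-typed T)) (t-inl (idP-typed S))

⊕-assoc : ∀ T₁ T₂ T₃ → ((T₁ ⊕ T₂) ⊕ T₃) ≅ (T₁ ⊕ (T₂ ⊕ T₃))
⊕-assoc T₁ T₂ T₃ = mk≅ (assocSel T₁ T₂ T₃) (unassocSel T₁ T₂ T₃)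
  (t-bra (t-bra (t-inl (idP-typed T₁)) (t-inr (t-inl (idP-typed T₂)))) (t-inr (t-inr (idP-typed T₃))))
  (t-bra (t-inl (t-inl (idP-typed T₁))) (t-bra (t-inl (t-inr (idP-typed T₂))) (t-inr (idP-typed T₃))))
  (assocSel-unassocSel T₁ T₂ T₃) (unassocSel-assocSel T₁ T₂ T₃)

-- Duality

dual-involutive : ∀ T → dual (dual T) ≡ T
dual-involutive end = refl
dual-involutive (¿ t ∙ T) = cong (¿ t ∙_) (dual-involutive T)
dual-involutive (! t ∙ T) = cong (! t ∙_) (dual-involutive T)
dual-involutive (T & S) = cong₂ _&_ (dual-involutive T) (dual-involutive S)
dual-involutive (T ⊕ S) = cong₂ _⊕_ (dual-involutive T) (dual-involutive S)

-- Exchanging l and r also reverses the order of the components.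
mirror : Proc → Proc
mirror 𝟎 = 𝟎
mirror (inp c x t P) = inp (dualC c) x t (mirror P)
mirror (out c e P) = out (dualC c) e (mirror P)
mirror (sel c ℓ P) = sel (dualC c) ℓ (mirror P)
mirror (bra c P Q) = bra (dualC c) (mirror P) (mirror Q)
mirror (ifte e P Q) = ifte e (mirror P) (mirror Q)
mirror (P ⋈ Q) = mirror Q ⋈ mirror P

mirrorᶜ : RCtx → RCtx
mirrorᶜ hole = hole
mirrorᶜ (C ⋈ₗ P) = mirror P ⋈ᵣ mirrorᶜ C
mirrorᶜ (P ⋈ᵣ C) = mirrorᶜ C ⋈ₗ mirror P

dualC-involutive : ∀ c → dualC (dualC c) ≡ c
dualC-involutive l = refl
dualC-involutive r = refl

mirror-involutive : ∀ P → mirror (mirror P) ≡ P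
mirror-involutive 𝟎 = refl
mirror-involutive (inp c x t P) = cong₂ (λ c P → inp c x t P) (dualC-involutive c) (mirror-involutive P)
mirror-involutive (out c e P) = cong₂ (λ c P → out c e P) (dualC-involutive c) (mirror-involutive P)
mirror-involutive (sel c ℓ P) = cong₂ (λ c P → sel c ℓ P) (dualC-involutive c) (mirror-involutive P)
mirror-involutive (bra c P Q) rewrite dualC-involutive c = cong₂ (bra c) (mirror-involutive P) (mirror-involutive Q)
mirror-involutive (ifte e P Q) = cong₂ (ifte e) (mirror-involutive P) (mirror-involutive Q)
mirror-involutive (P ⋈ Q) = cong₂ _⋈_ (mirror-involutive P) (mirror-involutive Q)

mirrorᶜ-involutive : ∀ C → mirrorᶜ (mirrorᶜ C) ≡ C
mirrorᶜ-involutive hole = refl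
mirrorᶜ-involutive (C ⋈ₗ P) = cong₂ _⋈ₗ_ (mirrorᶜ-involutive C) (mirror-involutive P)
mirrorᶜ-involutive (P ⋈ᵣ C) = cong₂ _⋈ᵣ_ (mirror-involutive P) (mirrorᶜ-involutive C)

mirror-plug : ∀ C P → mirror (plug C P) ≡ plug (mirrorᶜ C) (mirror P)
mirror-plug hole P = refl
mirror-plug (C ⋈ₗ Q) P = cong (mirror Q ⋈_) (mirror-plug C P)
mirror-plug (Q ⋈ᵣ C) P = cong (_⋈ mirror Q) (mirror-plug C P)

mirror-subst : ∀ P v x → mirror (substP P v x) ≡ substP (mirror P) v x
mirror-subst 𝟎 v x = refl
mirror-subst (inp c y t P) v x with x ≡ᵇ y
... | true = refl
... | false = cong (inp (dualC c) y t) (mirror-subst P v x)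
mirror-subst (out c e P) v x = cong (out (dualC c) _) (mirror-subst P v x)
mirror-subst (sel c ℓ P) v x = cong (sel (dualC c) ℓ) (mirror-subst P v x)
mirror-subst (bra c P Q) v x = cong₂ (bra (dualC c)) (mirror-subst P v x) (mirror-subst Q v x)
mirror-subst (ifte e P Q) v x = cong₂ (ifte _) (mirror-subst P v x) (mirror-subst Q v x)
mirror-subst (P ⋈ Q) v x = cong₂ _⋈_ (mirror-subst Q v x) (mirror-subst P v x)

mirror-idP : ∀ T → mirror (idP T) ≡ idP (dual T)
mirror-idP end = refl
mirror-idP (¿ t ∙ T) = cong (λ P → inp l 0 t (out r (var 0) P)) (mirror-idP T)
mirror-idP (! t ∙ T) = cong (λ P → inp r 0 t (out l (var 0) P)) (mirror-idP T)
mirror-idP (T & S) = cong₂ (λ P Q → bra l (sel r inl P) (sel r inr Q)) (mirror-idP T) (mirror-idP S)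
mirror-idP (T ⊕ S) = cong₂ (λ P Q → bra r (sel l inl P) (sel l inr Q)) (mirror-idP T) (mirror-idP S)

mirror-≡ₛ : ∀ {P Q} → P ≡ₛ Q → mirror P ≡ₛ mirror Q
mirror-≡ₛ s-refl = s-refl
mirror-≡ₛ (s-sym e) = s-sym (mirror-≡ₛ e)
mirror-≡ₛ (s-trans e f) = s-trans (mirror-≡ₛ e) (mirror-≡ₛ f)
mirror-≡ₛ (s-inp e) = s-inp (mirror-≡ₛ e)
mirror-≡ₛ (s-out e) = s-out (mirror-≡ₛ e)
mirror-≡ₛ (s-sel e) = s-sel (mirror-≡ₛ e)
mirror-≡ₛ (s-bra e f) = s-bra (mirror-≡ₛ e) (mirror-≡ₛ f)
mirror-≡ₛ (s-if e f) = s-if (mirror-≡ₛ e) (mirror-≡ₛ f)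
mirror-≡ₛ (s-par e f) = s-par (mirror-≡ₛ f) (mirror-≡ₛ e)
mirror-≡ₛ s-unit = s-unit
mirror-≡ₛ s-assoc = s-sym s-assoc

mirror-⟶ : ∀ {P Q} → P ⟶ Q → mirror P ⟶ mirror Q
mirror-⟶ (r-comm₁ {P = P} {x} {Q = Q} {v} d m) =
  subst (λ R → _ ⟶ (R ⋈ mirror P)) (sym (mirror-subst Q v x)) (r-comm₂ d m)
mirror-⟶ (r-comm₂ {x = x} {P = P} {Q = Q} {v} d m) =
  subst (λ R → _ ⟶ (mirror Q ⋈ R)) (sym (mirror-subst P v x)) (r-comm₁ d m)
mirror-⟶ (r-sel₁ {inl}) = r-sel₂
mirror-⟶ (r-sel₁ {inr}) = r-sel₂
mirror-⟶ (r-sel₂ {ℓ = inl}) = r-sel₁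
mirror-⟶ (r-sel₂ {ℓ = inr}) = r-sel₁
mirror-⟶ (r-if {b = true} d) = r-if d
mirror-⟶ (r-if {b = false} d) = r-if d
mirror-⟶ (r-ctx C {P} {Q} s) =
  subst₂ _⟶_ (sym (mirror-plug C P)) (sym (mirror-plug C Q)) (r-ctx (mirrorᶜ C) (mirror-⟶ s))
mirror-⟶ (r-struct e₁ s e₂) = r-struct (mirror-≡ₛ e₁) (mirror-⟶ s) (mirror-≡ₛ e₂)

mirror-⟶* : ∀ {P Q} → P ⟶* Q → mirror P ⟶* mirror Q
mirror-⟶* ε = ε
mirror-⟶* (s ◅ run) = mirror-⟶ s ◅ mirror-⟶* run

mirror-Stuck : ∀ {P} → Stuck P → Stuck (mirror P)
mirror-Stuck {P} st R s = st (mirror R) (subst (_⟶ mirror R) (mirror-involutive P) (mirror-⟶ s))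

mirror-Correct : ∀ {P} → Correct P → Correct (mirror P)
mirror-Correct {P} c Q run st =
  subst (_≡ₛ 𝟎) (mirror-involutive Q)
    (mirror-≡ₛ (c (mirror Q) (subst (_⟶* mirror Q) (mirror-involutive P) (mirror-⟶* run)) (mirror-Stuck st)))

Correct-mirror : ∀ P → Correct (mirror P) ⇔ Correct P
Correct-mirror P = mk⇔ (λ c → subst Correct (mirror-involutive P) (mirror-Correct c)) mirror-Correct

mirror-≈ : ∀ {P Q} → P ≈ Q → mirror P ≈ mirror Q
mirror-≈ {P} {Q} e C =
  ⇔.trans (≡⇒Correct⇔ (plug-mirror P)) (⇔.trans (Correct-mirror (plug (mirrorᶜ C) P))
  (⇔.trans (e (mirrorᶜ C)) (⇔.trans (⇔.sym (Correct-mirror (plug (mirrorᶜ C) Q))) (≡⇒Correct⇔ (sym (plug-mirror Q))))))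
  where
  ≡⇒Correct⇔ : ∀ {X Y} → X ≡ Y → Correct X ⇔ Correct Y
  ≡⇒Correct⇔ refl = ⇔.refl
  plug-mirror : ∀ R → plug C (mirror R) ≡ mirror (plug (mirrorᶜ C) R)
  plug-mirror R = trans (cong (λ D → plug D (mirror R)) (sym (mirrorᶜ-involutive C))) (sym (mirror-plug (mirrorᶜ C) R))

swap : SType × SType → SType × SType
swap (T , S) = S , T

mirror-typed : ∀ {Γ P J} → Γ ⊢ P ▷ J → Γ ⊢ mirror P ▷ swap J
mirror-typed (t-inp {c = l} d) = t-inp {c = r} (mirror-typed d)
mirror-typed (t-inp {c = r} d) = t-inp {c = l} (mirror-typed d)
mirror-typed (t-out {c = l} e d) = t-out {c = r} e (mirror-typed d)
mirror-typed (t-out {c = r} e d) = t-out {c = l} e (mirror-typed d)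
mirror-typed (t-bra {c = l} d₁ d₂) = t-bra {c = r} (mirror-typed d₁) (mirror-typed d₂)
mirror-typed (t-bra {c = r} d₁ d₂) = t-bra {c = l} (mirror-typed d₁) (mirror-typed d₂)
mirror-typed (t-inl {c = l} d) = t-inl {c = r} (mirror-typed d)
mirror-typed (t-inl {c = r} d) = t-inl {c = l} (mirror-typed d)
mirror-typed (t-inr {c = l} d) = t-inr {c = r} (mirror-typed d)
mirror-typed (t-inr {c = r} d) = t-inr {c = l} (mirror-typed d)
mirror-typed t-nil = t-nil
mirror-typed (t-if e d₁ d₂) = t-if e (mirror-typed d₁) (mirror-typed d₂)
mirror-typed {Γ} (t-par {P = P} {T' = T'} d₁ d₂) =
  t-par (mirror-typed d₂) (subst (λ U → Γ ⊢ mirror P ▷ (U , _)) (sym (dual-involutive T')) (mirror-typed d₁))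

≅-dual : ∀ {T S} → T ≅ S → dual T ≅ dual S
≅-dual {T} {S} (A , B , ⊢A , ⊢B , AB , BA) =
  mirror B , mirror A ,
  subst (λ U → [] ⊢ mirror B ▷ (U , dual S)) (sym (dual-involutive T)) (mirror-typed ⊢B) ,
  subst (λ U → [] ⊢ mirror A ▷ (U , dual T)) (sym (dual-involutive S)) (mirror-typed ⊢A) ,
  subst (mirror (A ⋈ B) ≈_) (mirror-idP T) (mirror-≈ AB) ,
  subst (mirror (B ⋈ A) ≈_) (mirror-idP S) (mirror-≈ BA)

≅-from-dual : ∀ {T S} → dual T ≅ dual S → T ≅ S
≅-from-dual {T} {S} e = subst₂ _≅_ (dual-involutive T) (dual-involutive S) (≅-dual e)

mainTheorem3 : (∀ (t s : BType) (T : SType) → (! t ∙ (! s ∙ T)) ≅ (! s ∙ (! t ∙ T)))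
  × (∀ (t s : BType) (T : SType) → (¿ t ∙ (¿ s ∙ T)) ≅ (¿ s ∙ (¿ t ∙ T)))
  × (∀ (t : BType) (T S : SType) → (! t ∙ (T ⊕ S)) ≅ ((! t ∙ T) ⊕ (! t ∙ S)))
  × (∀ (t : BType) (T S : SType) → (¿ t ∙ (T & S)) ≅ ((¿ t ∙ T) & (¿ t ∙ S)))
  × (∀ (T : SType) → (! unit ∙ T) ≅ T)
  × (∀ (T : SType) → (¿ unit ∙ T) ≅ T)
  × (∀ (T : SType) → (! bool ∙ T) ≅ (T ⊕ T))
  × (∀ (T : SType) → (¿ bool ∙ T) ≅ (T & T))
  × (∀ (T S : SType) → (T ⊕ S) ≅ (S ⊕ T))
  × (∀ (T S : SType) → (T & S) ≅ (S & T))
  × (∀ (T₁ T₂ T₃ : SType) → ((T₁ ⊕ T₂) ⊕ T₃) ≅ (T₁ ⊕ (T₂ ⊕ T₃)))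
  × (∀ (T₁ T₂ T₃ : SType) → ((T₁ & T₂) & T₃) ≅ (T₁ & (T₂ & T₃)))
mainTheorem3 =
  !-comm , (λ t s T → ≅-from-dual (!-comm t s (dual T))) ,
  !-distrib-⊕ , (λ t T S → ≅-from-dual (!-distrib-⊕ t (dual T) (dual S))) ,
  !unit≅ , (λ T → ≅-from-dual (!unit≅ (dual T))) ,
  !bool≅⊕ , (λ T → ≅-from-dual (!bool≅⊕ (dual T))) ,
  ⊕-comm , (λ T S → ≅-from-dual (⊕-comm (dual T) (dual S))) ,
  ⊕-assoc , (λ T₁ T₂ T₃ → ≅-from-dual (⊕-assoc (dual T₁) (dual T₂) (dual T₃)))
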